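{- Let $X\subseteq\mathrm{PVAR}$ be finite and $\alpha\ge|X|$. If $\varphi$ and $\psi$ are two satisfiable core types in $\mathrm{Type}(X,\alpha)$, then $\vdash_{\mathsf{C}(\ast)}(\varphi\ast\psi)\Leftrightarrow\mathrm{Box}_\ast(\varphi,\psi)$.
   Context: Logic $\mathrm{SL}(\ast,\mathrm{alloc})$: fix a countably infinite set $\mathrm{PVAR}$ of program variables and a countably infinite set $\mathrm{LOC}$ of locations. Formulae: $\varphi ::= x = y \mid x \hookrightarrow y \mid \mathrm{emp}\mid \mathrm{alloc}(x) \mid \neg\varphi \mid \varphi\wedge\varphi \mid \varphi \ast \varphi$ ($x,y\in\mathrm{PVAR}$). Memory states $(s,h)$: $s:\mathrm{PVAR}\to\mathrm{LOC}$, $h$ a partial function $\mathrm{LOC}\to\mathrm{LOC}$ with finite domain. $(s,h)\models x=y$ iff $s(x)=s(y)$; $\models\mathrm{emp}$ iff $\mathrm{dom}(h)=\emptyset$; $\models x\hookrightarrow y$ iff $s(x)\in\mathrm{dom}(h)$ and $h(s(x))=s(y)$; $\models\mathrm{alloc}(x)$ iff $s(x)\in\mathrm{dom}(h)$; Boolean connectives as usual; $\models\varphi_1\ast\varphi_2$ iff $h$ splits into two domain-disjoint heaps $h_1,h_2$ with $(s,h_i)\models\varphi_i$. A formula is satisfiable if some memory state satisfies it. Abbreviations: $\bot:=\neg(x=x)$, $\top:=\neg\bot$, $\mathrm{size}\ge0:=\top$, $\mathrm{size}\ge1:=\neg\mathrm{emp}$, $\mathrm{size}\ge\beta:=\neg\mathrm{emp}\ast\mathrm{size}\ge\beta-1$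 for $\beta\ge2$ (holds iff $|\mathrm{dom}(h)|\ge\beta$); $\mathrm{size}=\beta:=\mathrm{size}\ge\beta\wedge\neg\,\mathrm{size}\ge\beta+1$; $a\dot-b=\max(0,a-b)$. Core formulae: $\mathrm{Core}(X,\alpha)=\{x=y,\ \mathrm{alloc}(x),\ x\hookrightarrow y,\ \mathrm{size}\ge\beta : x,y\in X,\ \beta\in[0,\alpha]\}$; a literal is a core formula or its negation. A core type in $\mathrm{Type}(X,\alpha)$ is a conjunction of literals over $\mathrm{Core}(X,\alpha)$ in which, for each $\psi\in\mathrm{Core}(X,\alpha)$, exactly one of $\psi,\neg\psi$ occurs as a conjunct. "$L$ occurs in $\varphi$" means $L$ is one of the conjuncts of $\varphi$. $\mathrm{Box}_\ast(\varphi,\psi)$ is the conjunction of: every literal $x=y$ or $\neg(x=y)$ occurring in $\varphi$ or in $\psi$; every $\mathrm{alloc}(x)$ occurring in $\varphi$ or in $\psi$; every $\neg\mathrm{alloc}(x)$ occurring in both $\varphi$ and $\psi$; the literal $\neg x\hookrightarrow y$ whenever $\mathrm{alloc}(x)$ and $\neg x\hookrightarrow y$ both occur in $\varphi$ or both occur in $\psi$; the literal $\neg(x=x)$ whenever $\mathrm{alloc}(x)$ occurs in both $\varphi$ and $\psi$; every $x\hookrightarrow y$ occurring in $\varphi$ or in $\psi$; $\mathrm{size}\ge\beta_1+\beta_2$ whenever $\mathrm{size}\ge\beta_1$ occurs in $\varphi$ and $\mathrm{size}\ge\beta_2$ occurs in $\psi$; $\neg\,\mathrm{size}\ge\beta_1+\beta_2\dot-1$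 whenever $\neg\,\mathrm{size}\ge\beta_1$ occurs in $\varphi$ and $\neg\,\mathrm{size}\ge\beta_2$ occurs in $\psi$. The proof system $\mathsf{C}(\ast)$ (derivability is the least set of formulae containing all instances of the axiom schemata, metavariables ranging over formulae, variables and naturals, and closed under the rules) consists of all axiom schemata of classical propositional calculus, modus ponens, and: (1) $x=x$; (2) $\varphi\wedge x=y\Rightarrow\varphi'$, where $\varphi'$ is obtained from $\varphi$ by replacing every occurrence of $y$ with $x$; (3) $x\hookrightarrow y\Rightarrow\mathrm{alloc}(x)$; (4) $(x\hookrightarrow y\wedge x\hookrightarrow z)\Rightarrow y=z$; (7) $(\varphi\ast\psi)\Leftrightarrow(\psi\ast\varphi)$; (8) $((\varphi\ast\psi)\ast\chi)\Leftrightarrow(\varphi\ast(\psi\ast\chi))$; (9) $((\varphi\vee\psi)\ast\chi)\Rightarrow((\varphi\ast\chi)\vee(\psi\ast\chi))$; (10) $(\bot\ast\varphi)\Leftrightarrow\bot$; (11) $\varphi\Leftrightarrow(\varphi\ast\mathrm{emp})$; (12) $(\mathrm{alloc}(x)\ast\top)\Rightarrow\mathrm{alloc}(x)$; (13) $(\mathrm{alloc}(x)\ast\mathrm{alloc}(x))\Leftrightarrow\bot$; (14) $(\xi\ast\top)\Rightarrow\xi$ for $\xi\in\{\neg\mathrm{emp},\ x=y,\ \neg(x=y),\ x\hookrightarrow y\}$; (15) $(\neg\mathrm{alloc}(x)\ast\neg\mathrm{alloc}(x))\Rightarrow\neg\mathrm{alloc}(x)$; (16) $((\mathrm{alloc}(x)\wedge\neg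 x\hookrightarrow y)\ast\top)\Rightarrow\neg x\hookrightarrow y$; (17) $\mathrm{alloc}(x)\Rightarrow((\mathrm{alloc}(x)\wedge\mathrm{size}=1)\ast\top)$; (18) $\neg\mathrm{emp}\Rightarrow(\mathrm{size}=1\ast\top)$; (19) $(\neg\,\mathrm{size}\ge\beta_1\ast\neg\,\mathrm{size}\ge\beta_2)\Rightarrow\neg\,\mathrm{size}\ge\beta_1+\beta_2\dot-1$; (20) $(\mathrm{alloc}(x)\wedge\mathrm{alloc}(y)\wedge\neg(x=y))\Rightarrow\mathrm{size}\ge2$; and the rule: from $\varphi\Rightarrow\chi$ infer $(\varphi\ast\psi)\Rightarrow(\chi\ast\psi)$. -}

module Defs where

open import Data.Nat using (ℕ; zero; suc; _+_; _∸_; _≤_; _≡ᵇ_)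
open import Data.Bool using (Bool; true; false; if_then_else_; _∧_; _∨_; not)
open import Data.Maybe using (Maybe; just; nothing; _<∣>_)
open import Data.List using (List; []; _∷_; _++_; concatMap)
open import Data.Bool.ListAction using (any)
open import Data.List.Membership.Propositional using (_∈_)
open import Data.Product using (Σ; _×_; _,_)
open import Data.Sum using (_⊎_)
open import Relation.Nullary using (¬_)
open import Relation.Binary.PropositionalEquality using (_≡_)

-- Program variables and locations are both ℕ (countably infinite).

PVar : Set
PVar = ℕ

Loc : Set
Loc = ℕ

infixr 30 _∗_
infixr 25 _∧ᶠ_
infix  40 _≐_ _↪_
infix  35 ~_

data Form : Set where
  _≐_   : PVar → PVar → Form
  _↪_   : PVar → PVar → Form
  emp   : Form
  alloc : PVar → Form
  ~_    : Form → Form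
  _∧ᶠ_  : Form → Form → Form
  _∗_   : Form → Form → Form

infixr 20 _∨ᶠ_
infixr 15 _⇒_
infix  10 _⇔_

_∨ᶠ_ : Form → Form → Form
φ ∨ᶠ ψ = ~ (~ φ ∧ᶠ ~ ψ)

_⇒_ : Form → Form → Form
φ ⇒ ψ = ~ (φ ∧ᶠ ~ ψ)

_⇔_ : Form → Form → Form
φ ⇔ ψ = (φ ⇒ ψ) ∧ᶠ (ψ ⇒ φ)

⊥ᶠ : Form
⊥ᶠ = ~ (0 ≐ 0)

⊤ᶠ : Form
⊤ᶠ = ~ ⊥ᶠ

size≥ : ℕ → Form
size≥ zero = ⊤ᶠ
size≥ (suc zero) = ~ emp
size≥ (suc (suc b)) = ~ emp ∗ size≥ (suc b)

size= : ℕ → Form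
size= b = size≥ b ∧ᶠ ~ size≥ (suc b)

Store : Set
Store = PVar → Loc

-- A heap: partial function Loc ⇀ Loc with finite domain
record Heap : Set where
  constructor mkHeap
  field
    fun    : Loc → Maybe Loc
    bound  : ℕ
    finite : ∀ l → bound ≤ l → fun l ≡ nothing
open Heap public

Split : Heap → Heap → Heap → Set
Split h h₁ h₂ =
  (∀ l → fun h₁ l ≡ nothing ⊎ fun h₂ l ≡ nothing) ×
  (∀ l → fun h l ≡ (fun h₁ l <∣> fun h₂ l))

_,_⊨_ : Store → Heap → Form → Set
s , h ⊨ (x ≐ y) = s x ≡ s y
s , h ⊨ (x ↪ y) = fun h (s x) ≡ just (s y)
s , h ⊨ emp = ∀ l → fun h l ≡ nothing
s , h ⊨ alloc x = Σ Loc (λ v → fun h (s x) ≡ just v)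
s , h ⊨ (~ φ) = ¬ (s , h ⊨ φ)
s , h ⊨ (φ ∧ᶠ ψ) = (s , h ⊨ φ) × (s , h ⊨ ψ)
s , h ⊨ (φ ∗ ψ) =
  Σ Heap (λ h₁ → Σ Heap (λ h₂ → Split h h₁ h₂ × (s , h₁ ⊨ φ) × (s , h₂ ⊨ ψ)))

Satisfiable : Form → Set
Satisfiable φ = Σ Store (λ s → Σ Heap (λ h → s , h ⊨ φ))

-- Classical propositional calculus: all instances of propositional
-- tautologies (built from ¬ and ∧) serve as axioms.

data PForm : Set where
  patom : ℕ → PForm
  pnot  : PForm → PForm
  pand  : PForm → PForm → PForm

evalP : (ℕ → Bool) → PForm → Bool
evalP v (patom n) = v n
evalP v (pnot P) = not (evalP v P)
evalP v (pand P Q) = evalP v P ∧ evalP v Q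

Tautology : PForm → Set
Tautology P = ∀ (v : ℕ → Bool) → evalP v P ≡ true

instP : (ℕ → Form) → PForm → Form
instP σ (patom n) = σ n
instP σ (pnot P) = ~ instP σ P
instP σ (pand P Q) = instP σ P ∧ᶠ instP σ Q

renameVar : PVar → PVar → Form → Form
renameVar y x φ = go φ
  where
  r : PVar → PVar
  r z = if z ≡ᵇ y then x else z
  go : Form → Form
  go (a ≐ b) = r a ≐ r b
  go (a ↪ b) = r a ↪ r b
  go emp = emp
  go (alloc a) = alloc (r a)
  go (~ φ) = ~ go φ
  go (φ ∧ᶠ ψ) = go φ ∧ᶠ go ψ
  go (φ ∗ ψ) = go φ ∗ go ψ

infix 5 ⊢_

data ⊢_ : Form → Set where
  taut  : (P : PForm) → Tautology P → (σ : ℕ → Form) → ⊢ instP σ P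
  mp    : ∀ {φ ψ} → ⊢ φ → ⊢ (φ ⇒ ψ) → ⊢ ψ
  ax1   : ∀ x → ⊢ (x ≐ x)
  ax2   : ∀ φ x y → ⊢ ((φ ∧ᶠ (x ≐ y)) ⇒ renameVar y x φ)
  ax3   : ∀ x y → ⊢ ((x ↪ y) ⇒ alloc x)
  ax4   : ∀ x y z → ⊢ (((x ↪ y) ∧ᶠ (x ↪ z)) ⇒ (y ≐ z))
  ax7   : ∀ φ ψ → ⊢ ((φ ∗ ψ) ⇔ (ψ ∗ φ))
  ax8   : ∀ φ ψ χ → ⊢ (((φ ∗ ψ) ∗ χ) ⇔ (φ ∗ (ψ ∗ χ)))
  ax9   : ∀ φ ψ χ → ⊢ (((φ ∨ᶠ ψ) ∗ χ) ⇒ ((φ ∗ χ) ∨ᶠ (ψ ∗ χ)))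
  ax10  : ∀ φ → ⊢ ((⊥ᶠ ∗ φ) ⇔ ⊥ᶠ)
  ax11  : ∀ φ → ⊢ (φ ⇔ (φ ∗ emp))
  ax12  : ∀ x → ⊢ ((alloc x ∗ ⊤ᶠ) ⇒ alloc x)
  ax13  : ∀ x → ⊢ ((alloc x ∗ alloc x) ⇔ ⊥ᶠ)
  ax14a : ⊢ ((~ emp ∗ ⊤ᶠ) ⇒ ~ emp)
  ax14b : ∀ x y → ⊢ (((x ≐ y) ∗ ⊤ᶠ) ⇒ (x ≐ y))
  ax14c : ∀ x y → ⊢ ((~ (x ≐ y) ∗ ⊤ᶠ) ⇒ ~ (x ≐ y))
  ax14d : ∀ x y → ⊢ (((x ↪ y) ∗ ⊤ᶠ) ⇒ (x ↪ y))
  ax15  : ∀ x → ⊢ ((~ alloc x ∗ ~ alloc x) ⇒ ~ alloc x)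
  ax16  : ∀ x y → ⊢ (((alloc x ∧ᶠ ~ (x ↪ y)) ∗ ⊤ᶠ) ⇒ ~ (x ↪ y))
  ax17  : ∀ x → ⊢ (alloc x ⇒ ((alloc x ∧ᶠ size= 1) ∗ ⊤ᶠ))
  ax18  : ⊢ (~ emp ⇒ (size= 1 ∗ ⊤ᶠ))
  ax19  : ∀ β₁ β₂ → ⊢ ((~ size≥ β₁ ∗ ~ size≥ β₂) ⇒ ~ size≥ (β₁ + β₂ ∸ 1))
  ax20  : ∀ x y → ⊢ ((alloc x ∧ᶠ alloc y ∧ᶠ ~ (x ≐ y)) ⇒ size≥ 2)
  rule∗ : ∀ {φ χ} ψ → ⊢ (φ ⇒ χ) → ⊢ ((φ ∗ ψ) ⇒ (χ ∗ ψ))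

data CoreF : Set where
  eqC    : PVar → PVar → CoreF
  allocC : PVar → CoreF
  ptsC   : PVar → PVar → CoreF
  sizeC  : ℕ → CoreF

data Lit : Set where
  pos : CoreF → Lit
  neg : CoreF → Lit

⟦_⟧C : CoreF → Form
⟦ eqC x y ⟧C = x ≐ y
⟦ allocC x ⟧C = alloc x
⟦ ptsC x y ⟧C = x ↪ y
⟦ sizeC b ⟧C = size≥ b

⟦_⟧L : Lit → Form
⟦ pos c ⟧L = ⟦ c ⟧C
⟦ neg c ⟧L = ~ ⟦ c ⟧C

⋀ : List Lit → Form
⋀ [] = ⊤ᶠ
⋀ (L ∷ []) = ⟦ L ⟧L
⋀ (L ∷ Ls@(_ ∷ _)) = ⟦ L ⟧L ∧ᶠ ⋀ Ls

InCore : List PVar → ℕ → CoreF → Set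
InCore X α (eqC x y) = x ∈ X × y ∈ X
InCore X α (allocC x) = x ∈ X
InCore X α (ptsC x y) = x ∈ X × y ∈ X
InCore X α (sizeC b) = b ≤ α

atomOf : Lit → CoreF
atomOf (pos c) = c
atomOf (neg c) = c

IsCoreType : List PVar → ℕ → List Lit → Set
IsCoreType X α Ls =
  (∀ L → L ∈ Ls → InCore X α (atomOf L)) ×
  (∀ c → InCore X α c →
     (pos c ∈ Ls × ¬ (neg c ∈ Ls)) ⊎ (neg c ∈ Ls × ¬ (pos c ∈ Ls)))

eqCᵇ : CoreF → CoreF → Bool
eqCᵇ (eqC a b) (eqC c d) = (a ≡ᵇ c) ∧ (b ≡ᵇ d)
eqCᵇ (allocC a) (allocC c) = a ≡ᵇ c
eqCᵇ (ptsC a b) (ptsC c d) = (a ≡ᵇ c) ∧ (b ≡ᵇ d)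
eqCᵇ (sizeC a) (sizeC c) = a ≡ᵇ c
eqCᵇ _ _ = false

eqLᵇ : Lit → Lit → Bool
eqLᵇ (pos c) (pos d) = eqCᵇ c d
eqLᵇ (neg c) (neg d) = eqCᵇ c d
eqLᵇ _ _ = false

occurs : Lit → List Lit → Bool
occurs L Ls = any (eqLᵇ L) Ls

when : Bool → Lit → List Lit
when b L = if b then L ∷ [] else []

eqPart : Lit → List Lit
eqPart (pos (eqC x y)) = pos (eqC x y) ∷ []
eqPart (neg (eqC x y)) = neg (eqC x y) ∷ []
eqPart _ = []

allocPart : Lit → List Lit
allocPart (pos (allocC x)) = pos (allocC x) ∷ []
allocPart _ = []

negAllocBoth : List Lit → Lit → List Lit
negAllocBoth Ms (neg (allocC x)) = when (occurs (neg (allocC x)) Ms) (neg (allocC x))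
negAllocBoth Ms _ = []

negPtsPart : List Lit → Lit → List Lit
negPtsPart Ls (neg (ptsC x y)) = when (occurs (pos (allocC x)) Ls) (neg (ptsC x y))
negPtsPart Ls _ = []

selfNeq : List Lit → Lit → List Lit
selfNeq Ms (pos (allocC x)) = when (occurs (pos (allocC x)) Ms) (neg (eqC x x))
selfNeq Ms _ = []

ptsPart : Lit → List Lit
ptsPart (pos (ptsC x y)) = pos (ptsC x y) ∷ []
ptsPart _ = []

sizeSum : List Lit → Lit → List Lit
sizeSum Ms (pos (sizeC b₁)) = concatMap f Ms
  where
  f : Lit → List Lit
  f (pos (sizeC b₂)) = pos (sizeC (b₁ + b₂)) ∷ []
  f _ = []
sizeSum Ms _ = []

negSizeSum : List Lit → Lit → List Lit
negSizeSum Ms (neg (sizeC b₁)) = concatMap f Ms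
  where
  f : Lit → List Lit
  f (neg (sizeC b₂)) = neg (sizeC (b₁ + b₂ ∸ 1)) ∷ []
  f _ = []
negSizeSum Ms _ = []

boxLits : List Lit → List Lit → List Lit
boxLits Ls Ms =
  concatMap eqPart Ls ++ concatMap eqPart Ms ++
  concatMap allocPart Ls ++ concatMap allocPart Ms ++
  concatMap (negAllocBoth Ms) Ls ++
  concatMap (negPtsPart Ls) Ls ++ concatMap (negPtsPart Ms) Ms ++
  concatMap (selfNeq Ms) Ls ++
  concatMap ptsPart Ls ++ concatMap ptsPart Ms ++
  concatMap (sizeSum Ms) Ls ++
  concatMap (negSizeSum Ms) Ls

Box∗ : List Lit → List Lit → Form
Box∗ Ls Ms = ⋀ (boxLits Ls Ms)

module Submission where

-- (⇒) Each literal of Box∗ follows from φ ∗ ψ by a single axiom: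
--     ∗-upward closure of pure and pointer facts (12, 14, 16), the
--     disjointness axioms (13, 15) and the size arithmetic (19, size≥-∗).
-- (⇐) Fix models (s₁, h₁) ⊨ φ and (s₂, h₂) ⊨ ψ.  If s₁ and s₂ disagree on
--     an equality over X, or some x is allocated in both types, Box∗
--     contains a literal and its negation (or ¬ x = x) and is refutable.
--     Otherwise the equality pattern f = s₁ is shared.  Pick one
--     representative per f-class of allocated variables on each side
--     (S₁, S₂); Box∗ proves "alloc w" for w ∈ S₁ ++ S₂, "¬ alloc z" for the
--     other variables and the size bounds.  We peel off one memory cell
--     per representative ("peeling"), split the rest of the heap by size,
--     regroup into (cells S₁ ∗ rest₁) ∗ (cells S₂ ∗ rest₂), push the pointer
--     literals of Box∗ into the matching side and check that each side
--     proves its own core type.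

open import Defs
open import Data.Bool using (Bool; true; false; T; not; if_then_else_; _∧_; _∨_)
open import Data.Bool.Properties using (T-∧; T-≡)
open import Data.Empty using (⊥-elim) renaming (⊥ to Empty)
open import Data.List using (List; []; _∷_; _++_; length; map; concatMap; filter; deduplicate)
open import Data.List.Membership.Propositional using (_∈_; lose; find)
open import Data.List.Membership.Propositional.Properties
  using (∈-++⁺ˡ; ∈-++⁺ʳ; ∈-++⁻; ∈-concatMap⁺; ∈-concatMap⁻; ∈-map⁺; ∈-map⁻; ∈-filter⁺; ∈-filter⁻)
open import Data.List.Properties using (length-filter; length-map; length-++; length-deduplicate)
open import Data.List.Relation.Unary.All using (All; []; _∷_) renaming (lookup to All-lookup)
import Data.List.Relation.Unary.All as All
open import Data.List.Relation.Unary.All.Properties using () renaming (map⁺ to All-map⁺; ++⁺ to All-++⁺)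
open import Data.List.Relation.Unary.AllPairs using (AllPairs; []; _∷_)
open import Data.List.Relation.Unary.AllPairs.Properties using () renaming (++⁺ to AllPairs-++⁺)
open import Data.List.Relation.Unary.Any using (Any; here; there; any?) renaming (map to Any-map)
import Data.List.Relation.Unary.Any.Properties as AnyP
open import Data.List.Relation.Unary.Unique.Propositional using (Unique)
import Data.List.Relation.Unary.Unique.DecSetoid.Properties as UniqueDec
open import Data.Maybe using (Maybe; just; nothing; _<∣>_)
import Data.Maybe as Maybe
open import Data.Nat using (ℕ; zero; suc; _+_; _∸_; _≤_; _<_; z≤n; s≤s; _≡ᵇ_; _<ᵇ_; _≟_; _<?_)
open import Data.Nat.Properties
  using (≡ᵇ⇒≡; ≡⇒≡ᵇ; <ᵇ⇒<; <⇒<ᵇ; ≤∧≢⇒<; <⇒≱; ≤-refl; ≤-trans; n≤1+n; ≤-pred; <-irrefl; ≰⇒>;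
         +-suc; +-comm; ∸-+-assoc; +-∸-comm; +-∸-assoc; +-mono-≤; m≤n+m∸n; m+[n∸m]≡n; ≡-decSetoid)
open import Data.Product using (Σ; ∃; _×_; _,_; proj₁; proj₂)
open import Data.Sum using (_⊎_; inj₁; inj₂)
open import Data.Unit using (tt)
open import Function.Bundles using (Equivalence)
open import Relation.Binary.PropositionalEquality
  using (_≡_; _≢_; refl; sym; trans; cong; cong₂; subst; subst₂; module ≡-Reasoning)
import Relation.Binary.Construct.On as On
open import Relation.Nullary using (¬_; Dec; yes; no)
open import Relation.Nullary.Decidable using (¬?; _×-dec_)

≡ᵇ-refl : ∀ n → (n ≡ᵇ n) ≡ true
≡ᵇ-refl n = Equivalence.to T-≡ (≡⇒≡ᵇ n n refl)

≡ᵇ-true : ∀ {m n} → (m ≡ᵇ n) ≡ true → m ≡ n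
≡ᵇ-true {m} {n} e = ≡ᵇ⇒≡ m n (subst T (sym e) tt)

∧-true : ∀ {a b} → (a ∧ b) ≡ true → a ≡ true × b ≡ true
∧-true {true} e = refl , e

∨-true : ∀ {a b} → (a ∨ b) ≡ true → a ≡ true ⊎ b ≡ true
∨-true {true} _ = inj₁ refl
∨-true {false} e = inj₂ e

-- A PForm whose atoms are all below n is a tautology as soon as it holds
-- under the 2ⁿ valuations enumerated by `checkAll n`; the check runs by
-- evaluation, so `tautology` only needs the formula and an instantiation.
module Tautologies where

  atomsBelow : ℕ → PForm → Bool
  atomsBelow n (patom m) = m <ᵇ n
  atomsBelow n (pnot P) = atomsBelow n P
  atomsBelow n (pand P Q) = atomsBelow n P ∧ atomsBelow n Q

  T∧⁻ : ∀ {a b} → T (a ∧ b) → T a × T b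
  T∧⁻ = Equivalence.to T-∧

  T⇒≡true : ∀ {b} → T b → b ≡ true
  T⇒≡true = Equivalence.to T-≡

  evalP-cong< : ∀ n (v w : ℕ → Bool) P → T (atomsBelow n P) →
                (∀ m → m < n → v m ≡ w m) → evalP v P ≡ evalP w P
  evalP-cong< n v w (patom m) a agree = agree m (<ᵇ⇒< m n a)
  evalP-cong< n v w (pnot P) a agree = cong not (evalP-cong< n v w P a agree)
  evalP-cong< n v w (pand P Q) a agree =
    cong₂ _∧_ (evalP-cong< n v w P (proj₁ (T∧⁻ a)) agree) (evalP-cong< n v w Q (proj₂ (T∧⁻ a)) agree)

  evalP-cong : ∀ (v w : ℕ → Bool) P → (∀ m → v m ≡ w m) → evalP v P ≡ evalP w P
  evalP-cong v w (patom m) agree = agree m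
  evalP-cong v w (pnot P) agree = cong not (evalP-cong v w P agree)
  evalP-cong v w (pand P Q) agree = cong₂ _∧_ (evalP-cong v w P agree) (evalP-cong v w Q agree)

  set : ℕ → Bool → (ℕ → Bool) → ℕ → Bool
  set n b v m = if m ≡ᵇ n then b else v m

  checkAll : ℕ → (ℕ → Bool) → PForm → Bool
  checkAll zero v P = evalP v P
  checkAll (suc n) v P = checkAll n (set n true v) P ∧ checkAll n (set n false v) P

  set-agrees : ∀ n b (v w : ℕ → Bool) → w n ≡ b → (∀ m → suc n ≤ m → w m ≡ v m) →
               ∀ m → n ≤ m → w m ≡ set n b v m
  set-agrees n b v w wn agree m n≤m with m ≡ᵇ n in e
  ... | true = subst (λ k → w k ≡ b) (sym (≡ᵇ-true e)) wn
  ... | false = agree m (≤∧≢⇒< n≤m (λ n≡m → subst T e (≡⇒≡ᵇ m n (sym n≡m))))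

  checkAll-sound : ∀ n v P → T (checkAll n v P) →
                   ∀ w → (∀ m → n ≤ m → w m ≡ v m) → evalP w P ≡ true
  checkAll-sound zero v P c w agree = trans (evalP-cong w v P (λ m → agree m z≤n)) (T⇒≡true c)
  checkAll-sound (suc n) v P c w agree with w n in wn
  ... | true = checkAll-sound n (set n true v) P (proj₁ (T∧⁻ c)) w (set-agrees n true v w wn agree)
  ... | false = checkAll-sound n (set n false v) P (proj₂ (T∧⁻ c)) w (set-agrees n false v w wn agree)

  -- an arbitrary valuation w is replaced by its truncation w' below n
  decideTautology : ∀ n P → T (atomsBelow n P) → T (checkAll n (λ _ → false) P) → Tautology P
  decideTautology n P atoms check w =
    trans (evalP-cong< n w w' P atoms below) (checkAll-sound n (λ _ → false) P check w' above)
    where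
    w' : ℕ → Bool
    w' m = if m <ᵇ n then w m else false
    below : ∀ m → m < n → w m ≡ w' m
    below m m<n with m <ᵇ n in e
    ... | true = refl
    ... | false = ⊥-elim (subst T e (<⇒<ᵇ m<n))
    above : ∀ m → n ≤ m → w' m ≡ false
    above m n≤m with m <ᵇ n in e
    ... | true = ⊥-elim (<⇒≱ (<ᵇ⇒< m n (subst T (sym e) tt)) n≤m)
    ... | false = refl

  tautology : ∀ n P {atoms : T (atomsBelow n P)} {check : T (checkAll n (λ _ → false) P)} σ → ⊢ instP σ P
  tautology n P {atoms} {check} σ = taut P (decideTautology n P atoms check) σ

  infixr 6 _⊃_
  infixr 7 _∣_
  infixr 8 _&_

  _⊃_ _∣_ _&_ : PForm → PForm → PForm
  P ⊃ Q = pnot (pand P (pnot Q))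
  P ∣ Q = pnot (pand (pnot P) (pnot Q))
  _&_ = pand

  ¬p : PForm → PForm
  ¬p = pnot

  q0 q1 q2 q3 q4 : PForm
  q0 = patom 0
  q1 = patom 1
  q2 = patom 2
  q3 = patom 3
  q4 = patom 4

  inst : List Form → ℕ → Form
  inst [] _ = ⊤ᶠ
  inst (φ ∷ _) zero = φ
  inst (_ ∷ φs) (suc n) = inst φs n

open Tautologies using (tautology; inst; _⊃_; _∣_; _&_; ¬p; q0; q1; q2; q3; q4)

infixr 4 _⟫_

_⟫_ : ∀ {A B C} → ⊢ (A ⇒ B) → ⊢ (B ⇒ C) → ⊢ (A ⇒ C)
_⟫_ {A} {B} {C} h₁ h₂ = mp h₂ (mp h₁ (tautology 3 ((q0 ⊃ q1) ⊃ (q1 ⊃ q2) ⊃ (q0 ⊃ q2)) (inst (A ∷ B ∷ C ∷ []))))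

⇒-refl : ∀ {A} → ⊢ (A ⇒ A)
⇒-refl {A} = tautology 1 (q0 ⊃ q0) (inst (A ∷ []))

∧-intro : ∀ {G A B} → ⊢ (G ⇒ A) → ⊢ (G ⇒ B) → ⊢ (G ⇒ (A ∧ᶠ B))
∧-intro {G} {A} {B} h₁ h₂ =
  mp h₂ (mp h₁ (tautology 3 ((q0 ⊃ q1) ⊃ (q0 ⊃ q2) ⊃ (q0 ⊃ (q1 & q2))) (inst (G ∷ A ∷ B ∷ []))))

∧-elimˡ : ∀ {A B} → ⊢ ((A ∧ᶠ B) ⇒ A)
∧-elimˡ {A} {B} = tautology 2 ((q0 & q1) ⊃ q0) (inst (A ∷ B ∷ []))

∧-elimʳ : ∀ {A B} → ⊢ ((A ∧ᶠ B) ⇒ B)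
∧-elimʳ {A} {B} = tautology 2 ((q0 & q1) ⊃ q1) (inst (A ∷ B ∷ []))

∧-mono : ∀ {A B C D} → ⊢ (A ⇒ C) → ⊢ (B ⇒ D) → ⊢ ((A ∧ᶠ B) ⇒ (C ∧ᶠ D))
∧-mono h₁ h₂ = ∧-intro (∧-elimˡ ⟫ h₁) (∧-elimʳ ⟫ h₂)

∨-mono : ∀ {A B C D} → ⊢ (A ⇒ C) → ⊢ (B ⇒ D) → ⊢ ((A ∨ᶠ B) ⇒ (C ∨ᶠ D))
∨-mono {A} {B} {C} {D} h₁ h₂ =
  mp h₂ (mp h₁ (tautology 4 ((q0 ⊃ q2) ⊃ (q1 ⊃ q3) ⊃ ((q0 ∣ q1) ⊃ (q2 ∣ q3))) (inst (A ∷ B ∷ C ∷ D ∷ []))))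

⇔-to : ∀ {A B} → ⊢ (A ⇔ B) → ⊢ (A ⇒ B)
⇔-to {A} {B} h = mp h (tautology 2 (((q0 ⊃ q1) & (q1 ⊃ q0)) ⊃ (q0 ⊃ q1)) (inst (A ∷ B ∷ [])))

⇔-from : ∀ {A B} → ⊢ (A ⇔ B) → ⊢ (B ⇒ A)
⇔-from {A} {B} h = mp h (tautology 2 (((q0 ⊃ q1) & (q1 ⊃ q0)) ⊃ (q1 ⊃ q0)) (inst (A ∷ B ∷ [])))

⇔-intro : ∀ {A B} → ⊢ (A ⇒ B) → ⊢ (B ⇒ A) → ⊢ (A ⇔ B)
⇔-intro {A} {B} h₁ h₂ =
  mp h₂ (mp h₁ (tautology 2 ((q0 ⊃ q1) ⊃ (q1 ⊃ q0) ⊃ ((q0 ⊃ q1) & (q1 ⊃ q0))) (inst (A ∷ B ∷ []))))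

⇒⊤ : ∀ {A} → ⊢ (A ⇒ ⊤ᶠ)
⇒⊤ {A} = mp (ax1 0) (tautology 2 (q0 ⊃ (q1 ⊃ ¬p (¬p q0))) (inst ((0 ≐ 0) ∷ A ∷ [])))

⊥⇒ : ∀ {D} → ⊢ (⊥ᶠ ⇒ D)
⊥⇒ {D} = mp (ax1 0) (tautology 2 (q0 ⊃ (¬p q0 ⊃ q1)) (inst ((0 ≐ 0) ∷ D ∷ [])))

explode : ∀ {G A D} → ⊢ (G ⇒ A) → ⊢ (G ⇒ ~ A) → ⊢ (G ⇒ D)
explode {G} {A} {D} h₁ h₂ =
  mp h₂ (mp h₁ (tautology 3 ((q0 ⊃ q1) ⊃ (q0 ⊃ ¬p q1) ⊃ (q0 ⊃ q2)) (inst (G ∷ A ∷ D ∷ []))))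

contrapos : ∀ {A B} → ⊢ (A ⇒ B) → ⊢ (~ B ⇒ ~ A)
contrapos {A} {B} h = mp h (tautology 2 ((q0 ⊃ q1) ⊃ (¬p q1 ⊃ ¬p q0)) (inst (A ∷ B ∷ [])))

weaken : ∀ {G A} → ⊢ A → ⊢ (G ⇒ A)
weaken {G} {A} h = mp h (tautology 2 (q0 ⊃ (q1 ⊃ q0)) (inst (A ∷ G ∷ [])))

¬¬-elim : ∀ {A} → ⊢ (~ ~ A ⇒ A)
¬¬-elim {A} = tautology 1 (¬p (¬p q0) ⊃ q0) (inst (A ∷ []))

¬¬-intro : ∀ {A} → ⊢ (A ⇒ ~ ~ A)
¬¬-intro {A} = tautology 1 (q0 ⊃ ¬p (¬p q0)) (inst (A ∷ []))

incompatible : ∀ {G A Y} → ⊢ (G ⇒ A) → ⊢ (Y ⇒ ~ A) → ⊢ (~ (G ∧ᶠ Y))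
incompatible {G} {A} {Y} h₁ h₂ =
  mp h₂ (mp h₁ (tautology 3 ((q0 ⊃ q1) ⊃ (q2 ⊃ ¬p q1) ⊃ ¬p (q0 & q2)) (inst (G ∷ A ∷ Y ∷ []))))

incompatible⊥ : ∀ {G Y} → ⊢ (Y ⇒ ⊥ᶠ) → ⊢ (~ (G ∧ᶠ Y))
incompatible⊥ h = incompatible (weaken (ax1 0)) h

∗-comm : ∀ {A B} → ⊢ ((A ∗ B) ⇒ (B ∗ A))
∗-comm {A} {B} = ⇔-to (ax7 A B)

∗-monoˡ : ∀ {A B} C → ⊢ (A ⇒ B) → ⊢ ((A ∗ C) ⇒ (B ∗ C))
∗-monoˡ C h = rule∗ C h

∗-monoʳ : ∀ {A B} C → ⊢ (A ⇒ B) → ⊢ ((C ∗ A) ⇒ (C ∗ B))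
∗-monoʳ C h = ∗-comm ⟫ rule∗ C h ⟫ ∗-comm

∗-mono : ∀ {A B C D} → ⊢ (A ⇒ C) → ⊢ (B ⇒ D) → ⊢ ((A ∗ B) ⇒ (C ∗ D))
∗-mono {B = B} {C = C} h₁ h₂ = ∗-monoˡ B h₁ ⟫ ∗-monoʳ C h₂

∗-assocʳ : ∀ {A B C} → ⊢ (((A ∗ B) ∗ C) ⇒ (A ∗ (B ∗ C)))
∗-assocʳ {A} {B} {C} = ⇔-to (ax8 A B C)

∗-assocˡ : ∀ {A B C} → ⊢ ((A ∗ (B ∗ C)) ⇒ ((A ∗ B) ∗ C))
∗-assocˡ {A} {B} {C} = ⇔-from (ax8 A B C)

∗-interchange : ∀ {A B C D} → ⊢ (((A ∗ B) ∗ (C ∗ D)) ⇒ ((A ∗ C) ∗ (B ∗ D)))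
∗-interchange = ∗-assocʳ ⟫ ∗-monoʳ _ (∗-assocˡ ⟫ ∗-monoˡ _ ∗-comm ⟫ ∗-assocʳ) ⟫ ∗-assocˡ

∗-emp : ∀ {A} → ⊢ (A ⇒ (A ∗ emp))
∗-emp {A} = ⇔-to (ax11 A)

⊥∗ : ∀ {A} B → ⊢ (A ⇒ ⊥ᶠ) → ⊢ ((A ∗ B) ⇒ ⊥ᶠ)
⊥∗ B h = ∗-monoˡ B h ⟫ ⇔-to (ax10 B)

∗⊥ : ∀ {B} A → ⊢ (B ⇒ ⊥ᶠ) → ⊢ ((A ∗ B) ⇒ ⊥ᶠ)
∗⊥ A h = ∗-comm ⟫ ⊥∗ A h

-- Case split inside a ∗: to strengthen the left factor A by f it suffices
-- to refute (under G) the alternative in which f fails (axiom 9).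
strengthenˡ : ∀ {G f A B} → ⊢ (~ (G ∧ᶠ ((~ f ∧ᶠ A) ∗ B))) → ⊢ ((G ∧ᶠ (A ∗ B)) ⇒ ((f ∧ᶠ A) ∗ B))
strengthenˡ {G} {f} {A} {B} refute =
  mp refute (mp split∗ (tautology 5 ((q0 ⊃ (q1 ∣ q2)) ⊃ ¬p (q3 & q2) ⊃ ((q3 & q0) ⊃ q1))
    (inst ((A ∗ B) ∷ ((f ∧ᶠ A) ∗ B) ∷ ((~ f ∧ᶠ A) ∗ B) ∷ G ∷ []))))
  where
  split : ⊢ (A ⇒ ((f ∧ᶠ A) ∨ᶠ (~ f ∧ᶠ A)))
  split = tautology 2 (q0 ⊃ ((q1 & q0) ∣ (¬p q1 & q0))) (inst (A ∷ f ∷ []))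
  split∗ : ⊢ ((A ∗ B) ⇒ (((f ∧ᶠ A) ∗ B) ∨ᶠ ((~ f ∧ᶠ A) ∗ B)))
  split∗ = ∗-monoˡ B split ⟫ ax9 _ _ _

refute-along : ∀ {G G'} → ⊢ (G' ⇒ G) → ⊢ (~ G) → ⊢ (~ G')
refute-along h r = mp r (contrapos h)

strengthenʳ : ∀ {G f A B} → ⊢ (~ (G ∧ᶠ (A ∗ (~ f ∧ᶠ B)))) → ⊢ ((G ∧ᶠ (A ∗ B)) ⇒ (A ∗ (f ∧ᶠ B)))
strengthenʳ refute =
  ∧-mono ⇒-refl ∗-comm ⟫ strengthenˡ (refute-along (∧-mono ⇒-refl ∗-comm) refute) ⟫ ∗-comm

Conj : List Form → Form
Conj [] = ⊤ᶠ
Conj (φ ∷ φs) = φ ∧ᶠ Conj φs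

conj-elim : ∀ {φ φs} → φ ∈ φs → ⊢ (Conj φs ⇒ φ)
conj-elim (here refl) = ∧-elimˡ
conj-elim (there p) = ∧-elimʳ ⟫ conj-elim p

conj-intro : ∀ {G} φs → (∀ {φ} → φ ∈ φs → ⊢ (G ⇒ φ)) → ⊢ (G ⇒ Conj φs)
conj-intro [] h = ⇒⊤
conj-intro (φ ∷ φs) h = ∧-intro (h (here refl)) (conj-intro φs (λ p → h (there p)))

⋀-elim : ∀ {L Ls} → L ∈ Ls → ⊢ (⋀ Ls ⇒ ⟦ L ⟧L)
⋀-elim {Ls = L ∷ []} (here refl) = ⇒-refl
⋀-elim {Ls = L ∷ M ∷ Ls} (here refl) = ∧-elimˡ
⋀-elim {Ls = L ∷ M ∷ Ls} (there p) = ∧-elimʳ ⟫ ⋀-elim p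

⋀-intro : ∀ {G} Ls → (∀ {L} → L ∈ Ls → ⊢ (G ⇒ ⟦ L ⟧L)) → ⊢ (G ⇒ ⋀ Ls)
⋀-intro [] h = ⇒⊤
⋀-intro (L ∷ []) h = h (here refl)
⋀-intro (L ∷ M ∷ Ls) h = ∧-intro (h (here refl)) (⋀-intro (M ∷ Ls) (λ p → h (there p)))

strengthenAllʳ : ∀ {G A B} φs → (∀ {φ} → φ ∈ φs → ⊢ (~ (G ∧ᶠ (A ∗ (~ φ ∧ᶠ B))))) →
                 ⊢ ((G ∧ᶠ (A ∗ B)) ⇒ (A ∗ (Conj φs ∧ᶠ B)))
strengthenAllʳ [] h = ∧-elimʳ ⟫ ∗-monoʳ _ (∧-intro ⇒⊤ ⇒-refl)
strengthenAllʳ {G} {A} {B} (φ ∷ φs) h =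
  ∧-intro ∧-elimˡ (strengthenAllʳ φs (λ p → h (there p))) ⟫ strengthenʳ refute ⟫ ∗-monoʳ _ reassoc
  where
  refute : ⊢ (~ (G ∧ᶠ (A ∗ (~ φ ∧ᶠ (Conj φs ∧ᶠ B)))))
  refute = refute-along (∧-mono ⇒-refl (∗-monoʳ A (∧-mono ⇒-refl ∧-elimʳ))) (h (here refl))
  reassoc : ⊢ ((φ ∧ᶠ (Conj φs ∧ᶠ B)) ⇒ ((φ ∧ᶠ Conj φs) ∧ᶠ B))
  reassoc = tautology 3 ((q0 & (q1 & q2)) ⊃ ((q0 & q1) & q2)) (inst (φ ∷ Conj φs ∷ B ∷ []))

strengthenAllˡ : ∀ {G A B} φs → (∀ {φ} → φ ∈ φs → ⊢ (~ (G ∧ᶠ ((~ φ ∧ᶠ A) ∗ B)))) →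
                 ⊢ ((G ∧ᶠ (A ∗ B)) ⇒ ((Conj φs ∧ᶠ A) ∗ B))
strengthenAllˡ φs h =
  ∧-mono ⇒-refl ∗-comm ⟫ strengthenAllʳ φs (λ p → refute-along (∧-mono ⇒-refl ∗-comm) (h p)) ⟫ ∗-comm

-- Pure formulas: (dis)equalities hold of the store only, hence they may
-- be moved freely into and out of the factors of a ∗

data IsPure : Form → Set where
  eq-pure  : ∀ x y → IsPure (x ≐ y)
  neq-pure : ∀ x y → IsPure (~ (x ≐ y))

¬pure-∗⊤ : ∀ {p} → IsPure p → ⊢ ((~ p ∗ ⊤ᶠ) ⇒ ~ p)
¬pure-∗⊤ (eq-pure x y) = ax14c x y
¬pure-∗⊤ (neq-pure x y) = ∗-monoˡ _ ¬¬-elim ⟫ ax14b x y ⟫ ¬¬-intro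

¬Conj-pure-∗⊤ : ∀ {E} → All IsPure E → ⊢ ((~ Conj E ∗ ⊤ᶠ) ⇒ ~ Conj E)
¬Conj-pure-∗⊤ [] = ⊥∗ _ ¬¬-elim ⟫ ⊥⇒
¬Conj-pure-∗⊤ {p ∷ E} (pure ∷ pures) =
  ∗-monoˡ _ (tautology 2 (¬p (q0 & q1) ⊃ (¬p q0 ∣ ¬p q1)) (inst (p ∷ Conj E ∷ []))) ⟫ ax9 _ _ _ ⟫
  ∨-mono (¬pure-∗⊤ pure) (¬Conj-pure-∗⊤ pures) ⟫
  tautology 2 ((¬p q0 ∣ ¬p q1) ⊃ ¬p (q0 & q1)) (inst (p ∷ Conj E ∷ []))

pure-pushˡ : ∀ {E A B} → All IsPure E → ⊢ ((Conj E ∧ᶠ (A ∗ B)) ⇒ ((Conj E ∧ᶠ A) ∗ B))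
pure-pushˡ pures = strengthenˡ (incompatible ⇒-refl (∗-mono ∧-elimˡ ⇒⊤ ⟫ ¬Conj-pure-∗⊤ pures))

pure-pushʳ : ∀ {E A B} → All IsPure E → ⊢ ((Conj E ∧ᶠ (A ∗ B)) ⇒ (A ∗ (Conj E ∧ᶠ B)))
pure-pushʳ pures = ∧-mono ⇒-refl ∗-comm ⟫ pure-pushˡ pures ⟫ ∗-comm

pure-∗ : ∀ {E A A' B B'} → All IsPure E → ⊢ ((Conj E ∧ᶠ A) ⇒ A') → ⊢ ((Conj E ∧ᶠ B) ⇒ B') →
         ⊢ ((Conj E ∧ᶠ (A ∗ B)) ⇒ (A' ∗ B'))
pure-∗ pures h₁ h₂ = ∧-intro ∧-elimˡ (pure-pushˡ pures) ⟫ pure-pushʳ pures ⟫ ∗-mono h₁ h₂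

⊤∗size≥ : ∀ b → ⊢ ((⊤ᶠ ∗ size≥ b) ⇒ size≥ b)
⊤∗size≥ zero = ⇒⊤
⊤∗size≥ (suc zero) = ∗-comm ⟫ ax14a
⊤∗size≥ (suc (suc b)) = ∗-assocˡ ⟫ ∗-monoˡ _ (∗-comm ⟫ ax14a)

size≥-∗ : ∀ a b → ⊢ ((size≥ a ∗ size≥ b) ⇒ size≥ (a + b))
size≥-∗ zero b = ⊤∗size≥ b
size≥-∗ (suc zero) zero = ax14a
size≥-∗ (suc zero) (suc b) = ⇒-refl
size≥-∗ (suc (suc a)) b = ∗-assocʳ ⟫ ∗-monoʳ _ (size≥-∗ (suc a) b)

size≥-pred : ∀ a → ⊢ (size≥ (suc a) ⇒ size≥ a)
size≥-pred zero = ⇒⊤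
size≥-pred (suc zero) = ∗-monoʳ _ ⇒⊤ ⟫ ax14a
size≥-pred (suc (suc a)) = ∗-monoʳ _ (size≥-pred (suc a))

size≥-mono : ∀ {a b} → b ≤ a → ⊢ (size≥ a ⇒ size≥ b)
size≥-mono {zero} z≤n = ⇒-refl
size≥-mono {suc a} {zero} z≤n = ⇒⊤
size≥-mono {suc a} {suc b} (s≤s b≤a) = size≥-monoˢ a b b≤a
  where
  size≥-monoˢ : ∀ a b → b ≤ a → ⊢ (size≥ (suc a) ⇒ size≥ (suc b))
  size≥-monoˢ zero zero z≤n = ⇒-refl
  size≥-monoˢ (suc a) zero z≤n = size≥-pred (suc a) ⟫ size≥-monoˢ a zero z≤n
  size≥-monoˢ (suc a) (suc b) (s≤s b≤a) = ∗-monoʳ _ (size≥-monoˢ a b b≤a)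

¬size≥-mono : ∀ {a b} → b ≤ a → ⊢ (~ size≥ b ⇒ ~ size≥ a)
¬size≥-mono le = contrapos (size≥-mono le)

size=-∗ : ∀ a b → ⊢ ((size= a ∗ size= b) ⇒ size= (a + b))
size=-∗ a b =
  ∧-intro (∗-mono ∧-elimˡ ∧-elimˡ ⟫ size≥-∗ a b)
          (subst (λ k → ⊢ ((size= a ∗ size= b) ⇒ ~ size≥ k)) (+-suc a b)
                 (∗-mono ∧-elimʳ ∧-elimʳ ⟫ ax19 (suc a) (suc b)))

emp⇒size=0 : ⊢ (emp ⇒ size= 0)
emp⇒size=0 = ∧-intro ⇒⊤ ¬¬-intro

emp⇒¬alloc : ∀ x → ⊢ (emp ⇒ ~ alloc x)
emp⇒¬alloc x = ¬¬-intro ⟫ contrapos (ax17 x ⟫ ∗-monoˡ _ (∧-elimʳ ⟫ ∧-elimˡ) ⟫ ax14a)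

-- A one-cell heap (A ⇒ ¬ size ≥ 2) next to a heap of size < t − 1 has
-- size < t, contradicting G ⇒ size ≥ t.
one-cell-short : ∀ {G A B} t → ⊢ (G ⇒ size≥ t) → ⊢ (A ⇒ ~ size≥ 2) →
                 ⊢ (~ (G ∧ᶠ (A ∗ (~ size≥ (t ∸ 1) ∧ᶠ B))))
one-cell-short zero h₁ h₂ = incompatible⊥ (∗-mono ⇒⊤ (∧-elimˡ ⟫ ¬¬-elim) ⟫ ∗⊥ _ ⇒-refl)
one-cell-short (suc t) h₁ h₂ = incompatible h₁ (∗-mono h₂ ∧-elimˡ ⟫ ax19 2 t)

-- A heap of size ≥ 1 next to a heap of size ≥ u − 1 has size ≥ u,
-- contradicting G ⇒ ¬ size ≥ u.
upper-short : ∀ {G A B} u → ⊢ (G ⇒ ~ size≥ u) → ⊢ (A ⇒ size≥ 1) →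
              ⊢ (~ (G ∧ᶠ (A ∗ (~ ~ size≥ (u ∸ 1) ∧ᶠ B))))
upper-short u h₁ h₂ =
  incompatible h₁ (∗-mono h₂ (∧-elimˡ ⟫ ¬¬-elim) ⟫ size≥-∗ 1 (u ∸ 1) ⟫ size≥-mono (m≤n+m∸n u 1) ⟫ ¬¬-intro)

size≥-split : ∀ p q → ⊢ (size≥ (p + q) ⇒ (size= p ∗ size≥ q))
size≥-split zero q = ∗-emp ⟫ ∗-comm ⟫ ∗-monoˡ _ emp⇒size=0
size≥-split (suc p) q =
  ∧-intro ⇒-refl (size≥-mono (s≤s z≤n) ⟫ ax18) ⟫
  strengthenAllʳ (size≥ (p + q) ∷ []) (λ { (here refl) → one-cell-short (suc (p + q)) ⇒-refl ∧-elimʳ }) ⟫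
  ∗-monoʳ _ (∧-elimˡ ⟫ ∧-elimˡ ⟫ size≥-split p q) ⟫ ∗-assocˡ ⟫ ∗-monoˡ _ (size=-∗ 1 p)

size=-split : ∀ p q → ⊢ (size= (p + q) ⇒ (size= p ∗ size= q))
size=-split zero q = ∗-emp ⟫ ∗-comm ⟫ ∗-monoˡ _ emp⇒size=0
size=-split (suc p) q =
  ∧-intro ⇒-refl (∧-elimˡ ⟫ size≥-mono (s≤s z≤n) ⟫ ax18) ⟫
  strengthenAllʳ (size≥ (p + q) ∷ (~ size≥ (suc (p + q))) ∷ [])
    (λ { (here refl) → one-cell-short (suc (p + q)) ∧-elimˡ ∧-elimʳ
       ; (there (here refl)) →
           incompatible ∧-elimʳ (∗-mono ∧-elimˡ (∧-elimˡ ⟫ ¬¬-elim) ⟫ size≥-∗ 1 (suc (p + q)) ⟫ ¬¬-intro) }) ⟫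
  ∗-monoʳ _ (∧-elimˡ ⟫ ∧-mono ⇒-refl ∧-elimˡ ⟫ size=-split p q) ⟫ ∗-assocˡ ⟫ ∗-monoˡ _ (size=-∗ 1 p)

alloc-transfer : ∀ {G w z} → ⊢ (G ⇒ alloc w) → ⊢ (G ⇒ (z ≐ w)) → ⊢ (G ⇒ alloc z)
alloc-transfer {w = w} {z} h₁ h₂ = ∧-intro h₁ h₂ ⟫ rename
  where
  rename : ⊢ ((alloc w ∧ᶠ (z ≐ w)) ⇒ alloc z)
  rename = subst (λ b → ⊢ ((alloc w ∧ᶠ (z ≐ w)) ⇒ alloc (if b then z else w))) (≡ᵇ-refl w) (ax2 (alloc w) z w)

one-cell-¬alloc : ∀ {G w z} → ⊢ (G ⇒ alloc w) → ⊢ (G ⇒ ~ (w ≐ z)) → ⊢ (G ⇒ ~ size≥ 2) → ⊢ (G ⇒ ~ alloc z)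
one-cell-¬alloc {G} {w} {z} h₁ h₂ h₃ = mp h₃ (mp h₂ (mp h₁ (mp (ax20 w z)
  (tautology 5 (((q1 & (q2 & ¬p q3)) ⊃ q4) ⊃ (q0 ⊃ q1) ⊃ (q0 ⊃ ¬p q3) ⊃ (q0 ⊃ ¬p q4) ⊃ (q0 ⊃ ¬p q2))
    (inst (G ∷ alloc w ∷ alloc z ∷ (w ≐ z) ∷ size≥ 2 ∷ []))))))

-- a pointer x ↪ y of the whole heap lies in the part that allocates x (axiom 16)
pts-stays : ∀ {G C B x y} → ⊢ (C ⇒ alloc x) → ⊢ (G ⇒ (x ↪ y)) → ⊢ (~ (G ∧ᶠ ((~ (x ↪ y) ∧ᶠ C) ∗ B)))
pts-stays {x = x} {y} hc hg = incompatible hg (∗-mono (∧-intro (∧-elimʳ ⟫ hc) ∧-elimˡ) ⇒⊤ ⟫ ax16 x y)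

-- a pointer absent from the whole heap is absent from each part (axiom 14)
¬pts-stays : ∀ {G C B x y} → ⊢ (G ⇒ ~ (x ↪ y)) → ⊢ (~ (G ∧ᶠ ((~ ~ (x ↪ y) ∧ᶠ C) ∗ B)))
¬pts-stays {x = x} {y} hg = incompatible hg (∗-mono (∧-elimˡ ⟫ ¬¬-elim) ⇒⊤ ⟫ ax14d x y ⟫ ¬¬-intro)

¬allocs : List PVar → List Form
¬allocs Z = map (λ z → ~ alloc z) Z

¬alloc-split : ∀ {G A B} Z → ⊢ (G ⇒ Conj (¬allocs Z)) → ⊢ (G ⇒ (A ∗ B)) →
               ⊢ (G ⇒ ((Conj (¬allocs Z) ∧ᶠ A) ∗ (Conj (¬allocs Z) ∧ᶠ B)))
¬alloc-split {G} {A} {B} Z h∅ h∗ =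
  ∧-intro ⇒-refl (∧-intro ⇒-refl h∗ ⟫ strengthenAllˡ (¬allocs Z) left) ⟫ strengthenAllʳ (¬allocs Z) right
  where
  left : ∀ {g} → g ∈ ¬allocs Z → ⊢ (~ (G ∧ᶠ ((~ g ∧ᶠ A) ∗ B)))
  left p with ∈-map⁻ (λ z → ~ alloc z) p
  ... | z , _ , refl = incompatible (h∅ ⟫ conj-elim p) (∗-mono (∧-elimˡ ⟫ ¬¬-elim) ⇒⊤ ⟫ ax12 z ⟫ ¬¬-intro)
  right : ∀ {g} → g ∈ ¬allocs Z → ⊢ (~ (G ∧ᶠ ((Conj (¬allocs Z) ∧ᶠ A) ∗ (~ g ∧ᶠ B))))
  right p with ∈-map⁻ (λ z → ~ alloc z) p
  ... | z , _ , refl = incompatible (h∅ ⟫ conj-elim p) (∗-mono ⇒⊤ (∧-elimˡ ⟫ ¬¬-elim) ⟫ ∗-comm ⟫ ax12 z ⟫ ¬¬-intro)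

singleton : Loc → Loc → Heap
singleton l v = mkHeap (λ m → if m ≡ᵇ l then just v else nothing) (suc l) outside
  where
  outside : ∀ m → suc l ≤ m → (if m ≡ᵇ l then just v else nothing) ≡ nothing
  outside m le with m ≡ᵇ l in e
  ... | true = ⊥-elim (<-irrefl (sym (≡ᵇ-true e)) le)
  ... | false = refl

remove : Heap → Loc → Heap
remove h l = mkHeap (λ m → if m ≡ᵇ l then nothing else fun h m) (bound h) outside
  where
  outside : ∀ m → bound h ≤ m → (if m ≡ᵇ l then nothing else fun h m) ≡ nothing
  outside m le with m ≡ᵇ l
  ... | true = refl
  ... | false = finite h m le

split-singleton : ∀ h l v → fun h l ≡ just v → Split h (singleton l v) (remove h l)
split-singleton h l v hl = disjoint , union
  where
  disjoint : ∀ m → fun (singleton l v) m ≡ nothing ⊎ fun (remove h l) m ≡ nothing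
  disjoint m with m ≡ᵇ l
  ... | true = inj₂ refl
  ... | false = inj₁ refl
  union : ∀ m → fun h m ≡ (fun (singleton l v) m <∣> fun (remove h l) m)
  union m with m ≡ᵇ l in e
  ... | true = trans (cong (fun h) (≡ᵇ-true e)) hl
  ... | false = refl

singleton-nonempty : ∀ s l v → s , singleton l v ⊨ (~ emp)
singleton-nonempty s l v empty with empty l
... | p rewrite ≡ᵇ-refl l = just≢nothing p
  where
  just≢nothing : just v ≡ nothing → Empty
  just≢nothing ()

remove-other : ∀ h l l' → l' ≢ l → fun (remove h l) l' ≡ fun h l'
remove-other h l l' l'≢l with l' ≡ᵇ l in e
... | true = ⊥-elim (l'≢l (≡ᵇ-true e))
... | false = refl

<∣>-nothingˡ : ∀ {a b : Maybe Loc} → (a <∣> b) ≡ nothing → a ≡ nothing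
<∣>-nothingˡ {nothing} _ = refl

nonempty-∗ : ∀ s h h₁ h₂ → Split h h₁ h₂ → s , h₁ ⊨ (~ emp) → s , h ⊨ (~ emp)
nonempty-∗ s h h₁ h₂ (_ , union) nonempty empty =
  nonempty λ l → <∣>-nothingˡ (trans (sym (union l)) (empty l))

⊨size≥-pred : ∀ s h b → s , h ⊨ size≥ (suc b) → s , h ⊨ size≥ b
⊨size≥-pred s h zero _ k = k refl
⊨size≥-pred s h (suc zero) (h₁ , h₂ , split , nonempty , _) = nonempty-∗ s h h₁ h₂ split nonempty
⊨size≥-pred s h (suc (suc b)) (h₁ , h₂ , split , nonempty , rest) =
  h₁ , h₂ , split , nonempty , ⊨size≥-pred s h₂ (suc b) rest

⊨size≥-mono : ∀ s h {a b} → b ≤ a → s , h ⊨ size≥ a → s , h ⊨ size≥ b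
⊨size≥-mono s h {a} {b} b≤a sat with a ≟ b
... | yes refl = sat
⊨size≥-mono s h {zero} {zero} b≤a sat | no a≢b = ⊥-elim (a≢b refl)
⊨size≥-mono s h {suc a} {b} b≤a sat | no a≢b =
  ⊨size≥-mono s h (≤-pred (≤∧≢⇒< b≤a (λ e → a≢b (sym e)))) (⊨size≥-pred s h a sat)

Allocated : Heap → Loc → Set
Allocated h l = Σ Loc (λ v → fun h l ≡ just v)

-- k pairwise distinct allocated locations give size ≥ k: split off one
-- singleton cell per location
⊨size≥-distinct : ∀ s h (ls : List Loc) → AllPairs _≢_ ls → All (Allocated h) ls → s , h ⊨ size≥ (length ls)
⊨size≥-distinct s h [] _ _ k = k refl
⊨size≥-distinct s h (l ∷ []) _ ((v , hl) ∷ []) empty = just≢nothing (trans (sym hl) (empty l))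
  where
  just≢nothing : just v ≡ nothing → Empty
  just≢nothing ()
⊨size≥-distinct s h (l ∷ l' ∷ ls) (l∉ ∷ distinct) ((v , hl) ∷ allocated) =
  singleton l v , remove h l , split-singleton h l v hl , singleton-nonempty s l v ,
  ⊨size≥-distinct s (remove h l) (l' ∷ ls) distinct (still-allocated (l' ∷ ls) l∉ allocated)
  where
  still-allocated : ∀ ms → All (l ≢_) ms → All (Allocated h) ms → All (Allocated (remove h l)) ms
  still-allocated [] _ _ = []
  still-allocated (m ∷ ms) (l≢m ∷ l∉ms) ((w , hm) ∷ as) =
    (w , trans (remove-other h l m (λ q → l≢m (sym q))) hm) ∷ still-allocated ms l∉ms as

eqCᵇ-refl : ∀ c → eqCᵇ c c ≡ true
eqCᵇ-refl (eqC a b) rewrite ≡ᵇ-refl a | ≡ᵇ-refl b = refl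
eqCᵇ-refl (allocC a) = ≡ᵇ-refl a
eqCᵇ-refl (ptsC a b) rewrite ≡ᵇ-refl a | ≡ᵇ-refl b = refl
eqCᵇ-refl (sizeC a) = ≡ᵇ-refl a

eqCᵇ-sound : ∀ c d → eqCᵇ c d ≡ true → c ≡ d
eqCᵇ-sound (eqC a b) (eqC c d) e = let (a≡c , b≡d) = ∧-true e in cong₂ eqC (≡ᵇ-true a≡c) (≡ᵇ-true b≡d)
eqCᵇ-sound (allocC a) (allocC c) e = cong allocC (≡ᵇ-true e)
eqCᵇ-sound (ptsC a b) (ptsC c d) e = let (a≡c , b≡d) = ∧-true e in cong₂ ptsC (≡ᵇ-true a≡c) (≡ᵇ-true b≡d)
eqCᵇ-sound (sizeC a) (sizeC c) e = cong sizeC (≡ᵇ-true e)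
eqCᵇ-sound (eqC _ _) (allocC _) ()
eqCᵇ-sound (eqC _ _) (ptsC _ _) ()
eqCᵇ-sound (eqC _ _) (sizeC _) ()
eqCᵇ-sound (allocC _) (eqC _ _) ()
eqCᵇ-sound (allocC _) (ptsC _ _) ()
eqCᵇ-sound (allocC _) (sizeC _) ()
eqCᵇ-sound (ptsC _ _) (eqC _ _) ()
eqCᵇ-sound (ptsC _ _) (allocC _) ()
eqCᵇ-sound (ptsC _ _) (sizeC _) ()
eqCᵇ-sound (sizeC _) (eqC _ _) ()
eqCᵇ-sound (sizeC _) (allocC _) ()
eqCᵇ-sound (sizeC _) (ptsC _ _) ()

eqLᵇ-refl : ∀ L → eqLᵇ L L ≡ true
eqLᵇ-refl (pos c) = eqCᵇ-refl c
eqLᵇ-refl (neg c) = eqCᵇ-refl c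

eqLᵇ-sound : ∀ L M → eqLᵇ L M ≡ true → L ≡ M
eqLᵇ-sound (pos c) (pos d) e = cong pos (eqCᵇ-sound c d e)
eqLᵇ-sound (neg c) (neg d) e = cong neg (eqCᵇ-sound c d e)
eqLᵇ-sound (pos _) (neg _) ()
eqLᵇ-sound (neg _) (pos _) ()

occurs⇒∈ : ∀ {L} Ms → occurs L Ms ≡ true → L ∈ Ms
occurs⇒∈ {L} (M ∷ Ms) e with ∨-true {eqLᵇ L M} e
... | inj₁ L≡M = here (eqLᵇ-sound L M L≡M)
... | inj₂ later = there (occurs⇒∈ Ms later)

∈⇒occurs : ∀ {L Ms} → L ∈ Ms → occurs L Ms ≡ true
∈⇒occurs {L} (here refl) rewrite eqLᵇ-refl L = refl
∈⇒occurs {L} {M ∷ Ms} (there p) with eqLᵇ L M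
... | true = refl
... | false = ∈⇒occurs p

_∈?_ : ∀ L Ms → Dec (L ∈ Ms)
L ∈? Ms with occurs L Ms in e
... | true = yes (occurs⇒∈ Ms e)
... | false = no (λ p → true≢false (trans (sym (∈⇒occurs p)) e))
  where
  true≢false : true ≢ false
  true≢false ()

when-elim : ∀ {b K L} → L ∈ when b K → b ≡ true × L ≡ K
when-elim {true} (here refl) = refl , refl

when-intro : ∀ {b K} → b ≡ true → K ∈ when b K
when-intro refl = here refl

concatMap-elim : ∀ {L} (part : Lit → List Lit) Ks → L ∈ concatMap part Ks → ∃ λ K → K ∈ Ks × L ∈ part K
concatMap-elim part Ks p = find (∈-concatMap⁻ part p)

concatMap-intro : ∀ {K L} (part : Lit → List Lit) {Ks} → K ∈ Ks → L ∈ part K → L ∈ concatMap part Ks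
concatMap-intro part K∈ L∈ = ∈-concatMap⁺ part (lose K∈ L∈)

-- Each block of boxLits contributes literals of a fixed shape; the
-- decoders below recover the shape together with its origin.
module BlockCases (P : Lit → Set) (Ks : List Lit) where

  eqPart-case : ∀ {K L} → K ∈ Ks → L ∈ eqPart K →
    (∀ {x y} → pos (eqC x y) ∈ Ks → P (pos (eqC x y))) → (∀ {x y} → neg (eqC x y) ∈ Ks → P (neg (eqC x y))) → P L
  eqPart-case {pos (eqC _ _)} k (here refl) w w' = w k
  eqPart-case {neg (eqC _ _)} k (here refl) w w' = w' k

  allocPart-case : ∀ {K L} → K ∈ Ks → L ∈ allocPart K → (∀ {x} → pos (allocC x) ∈ Ks → P (pos (allocC x))) → P L
  allocPart-case {pos (allocC _)} k (here refl) w = w k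

  ptsPart-case : ∀ {K L} → K ∈ Ks → L ∈ ptsPart K → (∀ {x y} → pos (ptsC x y) ∈ Ks → P (pos (ptsC x y))) → P L
  ptsPart-case {pos (ptsC _ _)} k (here refl) w = w k

  negPtsPart-case : ∀ {K L} → K ∈ Ks → L ∈ negPtsPart Ks K →
    (∀ {x y} → pos (allocC x) ∈ Ks → neg (ptsC x y) ∈ Ks → P (neg (ptsC x y))) → P L
  negPtsPart-case {neg (ptsC x _)} k p w with when-elim {occurs (pos (allocC x)) Ks} p
  ... | a , refl = w (occurs⇒∈ Ks a) k

  block : ∀ {L} (part : Lit → List Lit) → (∀ {K} → K ∈ Ks → L ∈ part K → P L) → L ∈ concatMap part Ks → P L
  block part decode p = let (_ , k , q) = concatMap-elim part Ks p in decode k q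

sizeSum-intro : ∀ {a b} Ks → pos (sizeC b) ∈ Ks → pos (sizeC (a + b)) ∈ sizeSum Ks (pos (sizeC a))
sizeSum-intro (pos (sizeC _) ∷ Ks) (here refl) = here refl
sizeSum-intro (pos (sizeC _) ∷ Ks) (there p) = there (sizeSum-intro Ks p)
sizeSum-intro (pos (eqC _ _) ∷ Ks) (there p) = sizeSum-intro Ks p
sizeSum-intro (pos (allocC _) ∷ Ks) (there p) = sizeSum-intro Ks p
sizeSum-intro (pos (ptsC _ _) ∷ Ks) (there p) = sizeSum-intro Ks p
sizeSum-intro (neg _ ∷ Ks) (there p) = sizeSum-intro Ks p

sizeSum-elim : ∀ {a L} Ks → L ∈ sizeSum Ks (pos (sizeC a)) → ∃ λ b → pos (sizeC b) ∈ Ks × L ≡ pos (sizeC (a + b))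
sizeSum-elim (pos (sizeC b) ∷ Ks) (here refl) = b , here refl , refl
sizeSum-elim (pos (sizeC _) ∷ Ks) (there p) = let (b , b∈ , e) = sizeSum-elim Ks p in b , there b∈ , e
sizeSum-elim (pos (eqC _ _) ∷ Ks) p = let (b , b∈ , e) = sizeSum-elim Ks p in b , there b∈ , e
sizeSum-elim (pos (allocC _) ∷ Ks) p = let (b , b∈ , e) = sizeSum-elim Ks p in b , there b∈ , e
sizeSum-elim (pos (ptsC _ _) ∷ Ks) p = let (b , b∈ , e) = sizeSum-elim Ks p in b , there b∈ , e
sizeSum-elim (neg _ ∷ Ks) p = let (b , b∈ , e) = sizeSum-elim Ks p in b , there b∈ , e

negSizeSum-intro : ∀ {a b} Ks → neg (sizeC b) ∈ Ks → neg (sizeC (a + b ∸ 1)) ∈ negSizeSum Ks (neg (sizeC a))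
negSizeSum-intro (neg (sizeC _) ∷ Ks) (here refl) = here refl
negSizeSum-intro (neg (sizeC _) ∷ Ks) (there p) = there (negSizeSum-intro Ks p)
negSizeSum-intro (neg (eqC _ _) ∷ Ks) (there p) = negSizeSum-intro Ks p
negSizeSum-intro (neg (allocC _) ∷ Ks) (there p) = negSizeSum-intro Ks p
negSizeSum-intro (neg (ptsC _ _) ∷ Ks) (there p) = negSizeSum-intro Ks p
negSizeSum-intro (pos _ ∷ Ks) (there p) = negSizeSum-intro Ks p

negSizeSum-elim : ∀ {a L} Ks → L ∈ negSizeSum Ks (neg (sizeC a)) →
                  ∃ λ b → neg (sizeC b) ∈ Ks × L ≡ neg (sizeC (a + b ∸ 1))
negSizeSum-elim (neg (sizeC b) ∷ Ks) (here refl) = b , here refl , refl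
negSizeSum-elim (neg (sizeC _) ∷ Ks) (there p) = let (b , b∈ , e) = negSizeSum-elim Ks p in b , there b∈ , e
negSizeSum-elim (neg (eqC _ _) ∷ Ks) p = let (b , b∈ , e) = negSizeSum-elim Ks p in b , there b∈ , e
negSizeSum-elim (neg (allocC _) ∷ Ks) p = let (b , b∈ , e) = negSizeSum-elim Ks p in b , there b∈ , e
negSizeSum-elim (neg (ptsC _ _) ∷ Ks) p = let (b , b∈ , e) = negSizeSum-elim Ks p in b , there b∈ , e
negSizeSum-elim (pos _ ∷ Ks) p = let (b , b∈ , e) = negSizeSum-elim Ks p in b , there b∈ , e

-- The reasons for a literal to occur in Box∗(⋀ Ls, ⋀ Ms), one per clause
-- of its definition.
data BoxWitness (Ls Ms : List Lit) : Lit → Set where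
  eqˡ    : ∀ {x y} → pos (eqC x y) ∈ Ls → BoxWitness Ls Ms (pos (eqC x y))
  neqˡ   : ∀ {x y} → neg (eqC x y) ∈ Ls → BoxWitness Ls Ms (neg (eqC x y))
  eqʳ    : ∀ {x y} → pos (eqC x y) ∈ Ms → BoxWitness Ls Ms (pos (eqC x y))
  neqʳ   : ∀ {x y} → neg (eqC x y) ∈ Ms → BoxWitness Ls Ms (neg (eqC x y))
  allocˡ : ∀ {x} → pos (allocC x) ∈ Ls → BoxWitness Ls Ms (pos (allocC x))
  allocʳ : ∀ {x} → pos (allocC x) ∈ Ms → BoxWitness Ls Ms (pos (allocC x))
  ¬alloc : ∀ {x} → neg (allocC x) ∈ Ls → neg (allocC x) ∈ Ms → BoxWitness Ls Ms (neg (allocC x))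
  ¬ptsˡ  : ∀ {x y} → pos (allocC x) ∈ Ls → neg (ptsC x y) ∈ Ls → BoxWitness Ls Ms (neg (ptsC x y))
  ¬ptsʳ  : ∀ {x y} → pos (allocC x) ∈ Ms → neg (ptsC x y) ∈ Ms → BoxWitness Ls Ms (neg (ptsC x y))
  self≠  : ∀ {x} → pos (allocC x) ∈ Ls → pos (allocC x) ∈ Ms → BoxWitness Ls Ms (neg (eqC x x))
  ptsˡ   : ∀ {x y} → pos (ptsC x y) ∈ Ls → BoxWitness Ls Ms (pos (ptsC x y))
  ptsʳ   : ∀ {x y} → pos (ptsC x y) ∈ Ms → BoxWitness Ls Ms (pos (ptsC x y))
  size   : ∀ {a b} → pos (sizeC a) ∈ Ls → pos (sizeC b) ∈ Ms → BoxWitness Ls Ms (pos (sizeC (a + b)))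
  ¬size  : ∀ {a b} → neg (sizeC a) ∈ Ls → neg (sizeC b) ∈ Ms → BoxWitness Ls Ms (neg (sizeC (a + b ∸ 1)))

module _ {Ls Ms : List Lit} where

  private
    infixr 5 _▹_
    _▹_ : ∀ {L : Lit} (Ks : List Lit) {Ks' : List Lit} → L ∈ Ks' → L ∈ Ks ++ Ks'
    _▹_ = ∈-++⁺ʳ

    b₁ b₂ b₃ b₄ b₅ b₆ b₇ b₈ b₉ b₁₀ b₁₁ : List Lit
    b₁ = concatMap eqPart Ls
    b₂ = concatMap eqPart Ms
    b₃ = concatMap allocPart Ls
    b₄ = concatMap allocPart Ms
    b₅ = concatMap (negAllocBoth Ms) Ls
    b₆ = concatMap (negPtsPart Ls) Ls
    b₇ = concatMap (negPtsPart Ms) Ms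
    b₈ = concatMap (selfNeq Ms) Ls
    b₉ = concatMap ptsPart Ls
    b₁₀ = concatMap ptsPart Ms
    b₁₁ = concatMap (sizeSum Ms) Ls

  box-complete : ∀ {L} → BoxWitness Ls Ms L → L ∈ boxLits Ls Ms
  box-complete (eqˡ p) = ∈-++⁺ˡ (concatMap-intro eqPart p (here refl))
  box-complete (neqˡ p) = ∈-++⁺ˡ (concatMap-intro eqPart p (here refl))
  box-complete (eqʳ p) = b₁ ▹ ∈-++⁺ˡ (concatMap-intro eqPart p (here refl))
  box-complete (neqʳ p) = b₁ ▹ ∈-++⁺ˡ (concatMap-intro eqPart p (here refl))
  box-complete (allocˡ p) = b₁ ▹ b₂ ▹ ∈-++⁺ˡ (concatMap-intro allocPart p (here refl))
  box-complete (allocʳ p) = b₁ ▹ b₂ ▹ b₃ ▹ ∈-++⁺ˡ (concatMap-intro allocPart p (here refl))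
  box-complete (¬alloc p q) =
    b₁ ▹ b₂ ▹ b₃ ▹ b₄ ▹ ∈-++⁺ˡ (concatMap-intro (negAllocBoth Ms) p (when-intro (∈⇒occurs q)))
  box-complete (¬ptsˡ a p) =
    b₁ ▹ b₂ ▹ b₃ ▹ b₄ ▹ b₅ ▹ ∈-++⁺ˡ (concatMap-intro (negPtsPart Ls) p (when-intro (∈⇒occurs a)))
  box-complete (¬ptsʳ a p) =
    b₁ ▹ b₂ ▹ b₃ ▹ b₄ ▹ b₅ ▹ b₆ ▹ ∈-++⁺ˡ (concatMap-intro (negPtsPart Ms) p (when-intro (∈⇒occurs a)))
  box-complete (self≠ p q) =
    b₁ ▹ b₂ ▹ b₃ ▹ b₄ ▹ b₅ ▹ b₆ ▹ b₇ ▹ ∈-++⁺ˡ (concatMap-intro (selfNeq Ms) p (when-intro (∈⇒occurs q)))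
  box-complete (ptsˡ p) =
    b₁ ▹ b₂ ▹ b₃ ▹ b₄ ▹ b₅ ▹ b₆ ▹ b₇ ▹ b₈ ▹ ∈-++⁺ˡ (concatMap-intro ptsPart p (here refl))
  box-complete (ptsʳ p) =
    b₁ ▹ b₂ ▹ b₃ ▹ b₄ ▹ b₅ ▹ b₆ ▹ b₇ ▹ b₈ ▹ b₉ ▹ ∈-++⁺ˡ (concatMap-intro ptsPart p (here refl))
  box-complete (size p q) =
    b₁ ▹ b₂ ▹ b₃ ▹ b₄ ▹ b₅ ▹ b₆ ▹ b₇ ▹ b₈ ▹ b₉ ▹ b₁₀ ▹ ∈-++⁺ˡ (concatMap-intro (sizeSum Ms) p (sizeSum-intro Ms q))
  box-complete (¬size p q) =
    b₁ ▹ b₂ ▹ b₃ ▹ b₄ ▹ b₅ ▹ b₆ ▹ b₇ ▹ b₈ ▹ b₉ ▹ b₁₀ ▹ b₁₁ ▹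
    concatMap-intro (negSizeSum Ms) p (negSizeSum-intro Ms q)

  private
    negAllocBoth-case : ∀ {K L} → K ∈ Ls → L ∈ negAllocBoth Ms K → BoxWitness Ls Ms L
    negAllocBoth-case {neg (allocC x)} k p with when-elim {occurs (neg (allocC x)) Ms} p
    ... | n , refl = ¬alloc k (occurs⇒∈ Ms n)

    selfNeq-case : ∀ {K L} → K ∈ Ls → L ∈ selfNeq Ms K → BoxWitness Ls Ms L
    selfNeq-case {pos (allocC x)} k p with when-elim {occurs (pos (allocC x)) Ms} p
    ... | a , refl = self≠ k (occurs⇒∈ Ms a)

    sizeSum-case : ∀ {K L} → K ∈ Ls → L ∈ sizeSum Ms K → BoxWitness Ls Ms L
    sizeSum-case {pos (sizeC _)} k p with sizeSum-elim Ms p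
    ... | _ , q , refl = size k q

    negSizeSum-case : ∀ {K L} → K ∈ Ls → L ∈ negSizeSum Ms K → BoxWitness Ls Ms L
    negSizeSum-case {neg (sizeC _)} k p with negSizeSum-elim Ms p
    ... | _ , q , refl = ¬size k q

  private
    module ˡ = BlockCases (BoxWitness Ls Ms) Ls
    module ʳ = BlockCases (BoxWitness Ls Ms) Ms

  box-sound : ∀ {L} → L ∈ boxLits Ls Ms → BoxWitness Ls Ms L
  box-sound p with ∈-++⁻ b₁ p
  ... | inj₁ q = ˡ.block eqPart (λ k r → ˡ.eqPart-case k r eqˡ neqˡ) q
  ... | inj₂ p with ∈-++⁻ b₂ p
  ... | inj₁ q = ʳ.block eqPart (λ k r → ʳ.eqPart-case k r eqʳ neqʳ) q
  ... | inj₂ p with ∈-++⁻ b₃ p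
  ... | inj₁ q = ˡ.block allocPart (λ k r → ˡ.allocPart-case k r allocˡ) q
  ... | inj₂ p with ∈-++⁻ b₄ p
  ... | inj₁ q = ʳ.block allocPart (λ k r → ʳ.allocPart-case k r allocʳ) q
  ... | inj₂ p with ∈-++⁻ b₅ p
  ... | inj₁ q = ˡ.block (negAllocBoth Ms) negAllocBoth-case q
  ... | inj₂ p with ∈-++⁻ b₆ p
  ... | inj₁ q = ˡ.block (negPtsPart Ls) (λ k r → ˡ.negPtsPart-case k r ¬ptsˡ) q
  ... | inj₂ p with ∈-++⁻ b₇ p
  ... | inj₁ q = ʳ.block (negPtsPart Ms) (λ k r → ʳ.negPtsPart-case k r ¬ptsʳ) q
  ... | inj₂ p with ∈-++⁻ b₈ p
  ... | inj₁ q = ˡ.block (selfNeq Ms) selfNeq-case q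
  ... | inj₂ p with ∈-++⁻ b₉ p
  ... | inj₁ q = ˡ.block ptsPart (λ k r → ˡ.ptsPart-case k r ptsˡ) q
  ... | inj₂ p with ∈-++⁻ b₁₀ p
  ... | inj₁ q = ʳ.block ptsPart (λ k r → ʳ.ptsPart-case k r ptsʳ) q
  ... | inj₂ p with ∈-++⁻ b₁₁ p
  ... | inj₁ q = ˡ.block (sizeSum Ms) sizeSum-case q
  ... | inj₂ q = ˡ.block (negSizeSum Ms) negSizeSum-case q

  box⇒ : ∀ {L} → BoxWitness Ls Ms L → ⊢ (Box∗ Ls Ms ⇒ ⟦ L ⟧L)
  box⇒ w = ⋀-elim (box-complete w)

module _ {Ls Ms : List Lit} where

  private
    leftFact : ∀ {K} → K ∈ Ls → ⊢ ((⋀ Ls ∗ ⋀ Ms) ⇒ (⟦ K ⟧L ∗ ⊤ᶠ))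
    leftFact k = ∗-mono (⋀-elim k) ⇒⊤

    rightFact : ∀ {K} → K ∈ Ms → ⊢ ((⋀ Ls ∗ ⋀ Ms) ⇒ (⟦ K ⟧L ∗ ⊤ᶠ))
    rightFact k = ∗-comm ⟫ ∗-mono (⋀-elim k) ⇒⊤

    bothFacts : ∀ {K K'} → K ∈ Ls → K' ∈ Ms → ⊢ ((⋀ Ls ∗ ⋀ Ms) ⇒ (⟦ K ⟧L ∗ ⟦ K' ⟧L))
    bothFacts k k' = ∗-mono (⋀-elim k) (⋀-elim k')

    ¬pts-fact : ∀ {Ks x y} → pos (allocC x) ∈ Ks → neg (ptsC x y) ∈ Ks → ⊢ (⋀ Ks ⇒ (alloc x ∧ᶠ ~ (x ↪ y)))
    ¬pts-fact a n = ∧-intro (⋀-elim a) (⋀-elim n)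

  ∗⇒witnessed : ∀ {L} → BoxWitness Ls Ms L → ⊢ ((⋀ Ls ∗ ⋀ Ms) ⇒ ⟦ L ⟧L)
  ∗⇒witnessed (eqˡ {x} {y} k) = leftFact k ⟫ ax14b x y
  ∗⇒witnessed (neqˡ {x} {y} k) = leftFact k ⟫ ax14c x y
  ∗⇒witnessed (eqʳ {x} {y} k) = rightFact k ⟫ ax14b x y
  ∗⇒witnessed (neqʳ {x} {y} k) = rightFact k ⟫ ax14c x y
  ∗⇒witnessed (allocˡ {x} k) = leftFact k ⟫ ax12 x
  ∗⇒witnessed (allocʳ {x} k) = rightFact k ⟫ ax12 x
  ∗⇒witnessed (¬alloc {x} k k') = bothFacts k k' ⟫ ax15 x
  ∗⇒witnessed (¬ptsˡ {x} {y} a n) = ∗-mono (¬pts-fact a n) ⇒⊤ ⟫ ax16 x y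
  ∗⇒witnessed (¬ptsʳ {x} {y} a n) = ∗-comm ⟫ ∗-mono (¬pts-fact a n) ⇒⊤ ⟫ ax16 x y
  ∗⇒witnessed (self≠ {x} k k') = bothFacts k k' ⟫ ⇔-to (ax13 x) ⟫ ⊥⇒
  ∗⇒witnessed (ptsˡ {x} {y} k) = leftFact k ⟫ ax14d x y
  ∗⇒witnessed (ptsʳ {x} {y} k) = rightFact k ⟫ ax14d x y
  ∗⇒witnessed (size {a} {b} k k') = bothFacts k k' ⟫ size≥-∗ a b
  ∗⇒witnessed (¬size {a} {b} k k') = bothFacts k k' ⟫ ax19 a b

  ∗⇒box : ⊢ ((⋀ Ls ∗ ⋀ Ms) ⇒ Box∗ Ls Ms)
  ∗⇒box = ⋀-intro (boxLits Ls Ms) (λ p → ∗⇒witnessed (box-sound p))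

-- In a satisfiable core type every literal is decided by the model, and
-- the size literals are those below a threshold m ≤ α.
module SatisfiedType {X : List PVar} {α : ℕ} {Ls : List Lit} (ct : IsCoreType X α Ls)
                     {s : Store} {h : Heap} (sat : s , h ⊨ ⋀ Ls) where

  holds : ∀ {L} → L ∈ Ls → s , h ⊨ ⟦ L ⟧L
  holds = go Ls sat
    where
    go : ∀ {L} Ms → s , h ⊨ ⋀ Ms → L ∈ Ms → s , h ⊨ ⟦ L ⟧L
    go (L ∷ []) sat' (here refl) = sat'
    go (L ∷ M ∷ Ms) sat' (here refl) = proj₁ sat'
    go (L ∷ M ∷ Ms) sat' (there p) = go (M ∷ Ms) (proj₂ sat') p

  inCore : ∀ {L} → L ∈ Ls → InCore X α (atomOf L)
  inCore p = proj₁ ct _ p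

  pos-or-neg : ∀ c → InCore X α c → pos c ∈ Ls ⊎ neg c ∈ Ls
  pos-or-neg c ic with proj₂ ct c ic
  ... | inj₁ (p , _) = inj₁ p
  ... | inj₂ (n , _) = inj₂ n

  pos-and-neg : ∀ {c} → pos c ∈ Ls → neg c ∈ Ls → Empty
  pos-and-neg p n = holds n (holds p)

  true⇒pos : ∀ {c} → InCore X α c → s , h ⊨ ⟦ c ⟧C → pos c ∈ Ls
  true⇒pos {c} ic t with pos-or-neg c ic
  ... | inj₁ p = p
  ... | inj₂ n = ⊥-elim (holds n t)

  false⇒neg : ∀ {c} → InCore X α c → ¬ (s , h ⊨ ⟦ c ⟧C) → neg c ∈ Ls
  false⇒neg {c} ic f with pos-or-neg c ic
  ... | inj₁ p = ⊥-elim (f (holds p))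
  ... | inj₂ n = n

  largestSize≤ : ℕ → ℕ
  largestSize≤ zero = zero
  largestSize≤ (suc k) with pos (sizeC (suc k)) ∈? Ls
  ... | yes _ = suc k
  ... | no _ = largestSize≤ k

  largestSize≤-≤ : ∀ k → largestSize≤ k ≤ k
  largestSize≤-≤ zero = z≤n
  largestSize≤-≤ (suc k) with pos (sizeC (suc k)) ∈? Ls
  ... | yes _ = ≤-refl
  ... | no _ = ≤-trans (largestSize≤-≤ k) (n≤1+n k)

  largestSize≤-∈ : ∀ k → k ≤ α → pos (sizeC (largestSize≤ k)) ∈ Ls
  largestSize≤-∈ zero le = true⇒pos {sizeC 0} z≤n (λ k → k refl)
  largestSize≤-∈ (suc k) le with pos (sizeC (suc k)) ∈? Ls
  ... | yes p = p
  ... | no _ = largestSize≤-∈ k (≤-trans (n≤1+n k) le)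

  largestSize≤-largest : ∀ k {β} → β ≤ k → pos (sizeC β) ∈ Ls → β ≤ largestSize≤ k
  largestSize≤-largest zero z≤n _ = z≤n
  largestSize≤-largest (suc k) {β} le p with pos (sizeC (suc k)) ∈? Ls
  ... | yes _ = le
  ... | no ¬p with β ≟ suc k
  ...   | yes refl = ⊥-elim (¬p p)
  ...   | no β≢ = largestSize≤-largest k (≤-pred (≤∧≢⇒< le β≢)) p

  m : ℕ
  m = largestSize≤ α

  m≤α : m ≤ α
  m≤α = largestSize≤-≤ α

  size≥m∈ : pos (sizeC m) ∈ Ls
  size≥m∈ = largestSize≤-∈ α ≤-refl

  pos-size⇒≤m : ∀ {β} → pos (sizeC β) ∈ Ls → β ≤ m
  pos-size⇒≤m p = largestSize≤-largest α (inCore p) p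

  ≤m⇒pos-size : ∀ {β} → β ≤ m → pos (sizeC β) ∈ Ls
  ≤m⇒pos-size le = true⇒pos (≤-trans le m≤α) (⊨size≥-mono s h le (holds size≥m∈))

  neg-size⇒m< : ∀ {β} → neg (sizeC β) ∈ Ls → m < β
  neg-size⇒m< n = ≰⇒> (λ le → pos-and-neg (≤m⇒pos-size le) n)

  ¬size≥1+m∈ : m < α → neg (sizeC (suc m)) ∈ Ls
  ¬size≥1+m∈ lt with pos-or-neg (sizeC (suc m)) lt
  ... | inj₁ p = ⊥-elim (<-irrefl refl (pos-size⇒≤m p))
  ... | inj₂ n = n

  allocVars : List PVar
  allocVars = filter (λ x → pos (allocC x) ∈? Ls) X

  allocVars⁻ : ∀ {x} → x ∈ allocVars → x ∈ X × pos (allocC x) ∈ Ls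
  allocVars⁻ = ∈-filter⁻ (λ x → pos (allocC x) ∈? Ls)

  allocVars⁺ : ∀ {x} → x ∈ X → pos (allocC x) ∈ Ls → x ∈ allocVars
  allocVars⁺ = ∈-filter⁺ (λ x → pos (allocC x) ∈? Ls)

  length-allocVars : length allocVars ≤ length X
  length-allocVars = length-filter (λ x → pos (allocC x) ∈? Ls) X

  alloc-closed : ∀ {x y} → y ∈ X → pos (allocC x) ∈ Ls → s x ≡ s y → pos (allocC y) ∈ Ls
  alloc-closed {x} {y} y∈X p e with holds p
  ... | v , hx = true⇒pos {allocC y} y∈X (v , subst (λ l → fun h l ≡ just v) e hx)

  pts⇒alloc : ∀ {x y} → pos (ptsC x y) ∈ Ls → pos (allocC x) ∈ Ls
  pts⇒alloc {x} {y} p = true⇒pos {allocC x} (proj₁ (inCore p)) (s y , holds p)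

-- One representative per class of the kernel of f

module Representatives (f : ℕ → ℕ) where

  Distinct : List ℕ → Set
  Distinct = AllPairs (λ a b → f a ≢ f b)

  reps : List ℕ → List ℕ
  reps = deduplicate (λ a b → f a ≟ f b)

  reps-⊆ : ∀ xs {r} → r ∈ reps xs → r ∈ xs
  reps-⊆ xs = AnyP.deduplicate⁻ (λ a b → f a ≟ f b)

  reps-cover : ∀ xs {y} → y ∈ xs → ∃ λ r → r ∈ reps xs × f r ≡ f y
  reps-cover xs {y} y∈ =
    find (AnyP.deduplicate⁺ (λ a b → f a ≟ f b) {P = λ r → f r ≡ f y} trans (Any-map (λ e → cong f (sym e)) y∈))

  reps-distinct : ∀ xs → Distinct (reps xs)
  reps-distinct = UniqueDec.deduplicate-! (On.decSetoid ≡-decSetoid f)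

  length-reps : ∀ xs → length (reps xs) ≤ length xs
  length-reps = length-deduplicate (λ a b → f a ≟ f b)

-- Peeling cells off a heap whose equality pattern is known

shrink : ℕ → Maybe ℕ → Maybe ℕ
shrink k = Maybe.map (_∸ k)

shrink-0 : ∀ u → shrink 0 u ≡ u
shrink-0 nothing = refl
shrink-0 (just v) = refl

shrink-just : ∀ k u {w} → shrink k u ≡ just w → ∃ λ v → u ≡ just v × w ≡ v ∸ k
shrink-just k (just v) refl = v , refl , refl

shrink-shrink : ∀ a b u → shrink b (shrink a u) ≡ shrink (a + b) u
shrink-shrink a b nothing = refl
shrink-shrink a b (just v) = cong just (∸-+-assoc v a b)

-- Throughout, the pure literals E fix the equalities among X to be the
-- kernel of f.
module Cells (X : List PVar) (f : PVar → ℕ) {E : List Form} (pures : All IsPure E)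
  (eq∈ : ∀ {x y} → x ∈ X → y ∈ X → f x ≡ f y → (x ≐ y) ∈ E)
  (neq∈ : ∀ {x y} → x ∈ X → y ∈ X → f x ≢ f y → (~ (x ≐ y)) ∈ E) where

  open Representatives f using (Distinct)

  Eqs : Form
  Eqs = Conj E

  cell : PVar → Form
  cell w = alloc w ∧ᶠ size= 1

  cells : List PVar → Form
  cells [] = emp
  cells (w ∷ W) = cell w ∗ cells W

  cell-alloc : ∀ {w z} → w ∈ X → z ∈ X → f w ≡ f z → ⊢ ((Eqs ∧ᶠ cell w) ⇒ alloc z)
  cell-alloc w∈ z∈ e = alloc-transfer (∧-elimʳ ⟫ ∧-elimˡ) (∧-elimˡ ⟫ conj-elim (eq∈ z∈ w∈ (sym e)))

  cell-¬alloc : ∀ {w z} → w ∈ X → z ∈ X → f w ≢ f z → ⊢ ((Eqs ∧ᶠ cell w) ⇒ ~ alloc z)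
  cell-¬alloc w∈ z∈ ne =
    one-cell-¬alloc (∧-elimʳ ⟫ ∧-elimˡ) (∧-elimˡ ⟫ conj-elim (neq∈ w∈ z∈ ne)) (∧-elimʳ ⟫ ∧-elimʳ ⟫ ∧-elimʳ)

  Apart : List PVar → PVar → Set
  Apart W z = ¬ Any (λ w → f w ≡ f z) W

  apart? : ∀ W z → Dec (Apart W z)
  apart? W z = ¬? (any? (λ w → f w ≟ f z) W)

  outside : List PVar → List PVar
  outside W = filter (apart? W) X

  upper : Maybe ℕ → List Form
  upper nothing = []
  upper (just u) = (~ size≥ u) ∷ []

  -- a heap allocating W and nothing else of X, with at least t cells
  -- and, if u = just v, fewer than v
  remaining : List PVar → ℕ → Maybe ℕ → List Form
  remaining W t u = map alloc W ++ ¬allocs (outside W) ++ size≥ t ∷ upper u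

  Remaining : List PVar → ℕ → Maybe ℕ → Form
  Remaining W t u = Conj (remaining W t u)

  data RemainingLit (W : List PVar) (t : ℕ) (u : Maybe ℕ) : Form → Set where
    allocated   : ∀ {w} → w ∈ W → RemainingLit W t u (alloc w)
    unallocated : ∀ {z} → z ∈ X → Apart W z → RemainingLit W t u (~ alloc z)
    lower       : RemainingLit W t u (size≥ t)
    upper-bound : ∀ {v} → u ≡ just v → RemainingLit W t u (~ size≥ v)

  remaining-view : ∀ {W t u g} → g ∈ remaining W t u → RemainingLit W t u g
  remaining-view {W} {t} {u} p with ∈-++⁻ (map alloc W) p
  ... | inj₁ q = let (w , w∈ , e) = ∈-map⁻ alloc q in subst (RemainingLit W t u) (sym e) (allocated w∈)
  ... | inj₂ q with ∈-++⁻ (¬allocs (outside W)) q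
  ...   | inj₁ r = let (z , z∈ , e) = ∈-map⁻ (λ z → ~ alloc z) r
                       (z∈X , apart) = ∈-filter⁻ (apart? W) z∈
                   in subst (RemainingLit W t u) (sym e) (unallocated z∈X apart)
  ...   | inj₂ (here refl) = lower
  remaining-view {u = just v} p | inj₂ q | inj₂ (there (here refl)) = upper-bound refl

  remaining-intro : ∀ {W t u g} → RemainingLit W t u g → g ∈ remaining W t u
  remaining-intro (allocated w∈) = ∈-++⁺ˡ (∈-map⁺ alloc w∈)
  remaining-intro {W} (unallocated z∈ apart) =
    ∈-++⁺ʳ (map alloc W) (∈-++⁺ˡ (∈-map⁺ (λ z → ~ alloc z) (∈-filter⁺ (apart? W) z∈ apart)))
  remaining-intro {W} lower = ∈-++⁺ʳ (map alloc W) (∈-++⁺ʳ (¬allocs (outside W)) (here refl))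
  remaining-intro {W} (upper-bound refl) = ∈-++⁺ʳ (map alloc W) (∈-++⁺ʳ (¬allocs (outside W)) (there (here refl)))

  -- One step of peeling: the cell at w is split off (axiom 17) and every
  -- conjunct describing the rest is forced into the rest by refuting
  -- the alternative in which it fails there.
  peel-one : ∀ {w W} t u → w ∈ X → All (_∈ X) W → All (λ w' → f w ≢ f w') W →
    ⊢ ((Eqs ∧ᶠ Remaining (w ∷ W) t u) ⇒ (cell w ∗ Remaining W (t ∸ 1) (shrink 1 u)))
  peel-one {w} {W} t u w∈ W⊆X w-distinct =
    ∧-intro ⇒-refl cell∗⊤ ⟫ strengthenAllʳ (remaining W (t ∸ 1) (shrink 1 u)) refute ⟫ ∗-mono ∧-elimʳ ∧-elimˡ
    where
    G A : Form
    G = Eqs ∧ᶠ Remaining (w ∷ W) t u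
    A = Eqs ∧ᶠ cell w
    from-G : ∀ {g} → RemainingLit (w ∷ W) t u g → ⊢ (G ⇒ g)
    from-G r = ∧-elimʳ ⟫ conj-elim (remaining-intro r)
    cell∗⊤ : ⊢ (G ⇒ (A ∗ ⊤ᶠ))
    cell∗⊤ = ∧-intro ∧-elimˡ (from-G (allocated (here refl)) ⟫ ax17 w) ⟫ pure-pushˡ pures
    refute-lit : ∀ {g} → RemainingLit W (t ∸ 1) (shrink 1 u) g → ⊢ (~ (G ∧ᶠ (A ∗ (~ g ∧ᶠ ⊤ᶠ))))
    refute-lit (allocated {w'} w'∈) =
      incompatible (from-G (allocated (there w'∈)))
        (∗-mono (cell-¬alloc w∈ (All-lookup W⊆X w'∈) (All-lookup w-distinct w'∈)) ∧-elimˡ ⟫ ax15 w')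
    refute-lit (unallocated {z} z∈ apart) with f w ≟ f z
    ... | yes e = incompatible⊥ (∗-mono (cell-alloc w∈ z∈ e) (∧-elimˡ ⟫ ¬¬-elim) ⟫ ⇔-to (ax13 z))
    ... | no ne = incompatible (from-G (unallocated z∈ λ { (here e) → ne e ; (there p) → apart p }))
                    (∗-mono ⇒⊤ (∧-elimˡ ⟫ ¬¬-elim) ⟫ ∗-comm ⟫ ax12 z ⟫ ¬¬-intro)
    refute-lit lower = one-cell-short t (from-G lower) (∧-elimʳ ⟫ ∧-elimʳ ⟫ ∧-elimʳ)
    refute-lit (upper-bound e) with shrink-just 1 u e
    ... | v , u≡ , refl = upper-short v (from-G (upper-bound u≡)) (∧-elimʳ ⟫ ∧-elimʳ ⟫ ∧-elimˡ)
    refute : ∀ {g} → g ∈ remaining W (t ∸ 1) (shrink 1 u) → ⊢ (~ (G ∧ᶠ (A ∗ (~ g ∧ᶠ ⊤ᶠ))))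
    refute p = refute-lit (remaining-view p)

  peel : ∀ W t u → All (_∈ X) W → Distinct W →
    ⊢ ((Eqs ∧ᶠ Remaining W t u) ⇒ (cells W ∗ Remaining [] (t ∸ length W) (shrink (length W) u)))
  peel [] t u _ _ =
    subst (λ u' → ⊢ ((Eqs ∧ᶠ Remaining [] t u) ⇒ (emp ∗ Remaining [] t u'))) (sym (shrink-0 u))
      (∧-elimʳ ⟫ ∗-emp ⟫ ∗-comm)
  peel (w ∷ W) t u (w∈ ∷ W⊆X) (w-distinct ∷ distinct) =
    ∧-intro ∧-elimˡ (peel-one t u w∈ W⊆X w-distinct) ⟫
    pure-∗ pures ∧-elimʳ (peel W (t ∸ 1) (shrink 1 u) W⊆X distinct) ⟫ ∗-assocˡ ⟫
    subst₂ (λ t' u' → ⊢ (((cell w ∗ cells W) ∗ Remaining [] (t ∸ 1 ∸ length W) (shrink (length W) (shrink 1 u))) ⇒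
                         ((cell w ∗ cells W) ∗ Remaining [] t' u')))
           (∸-+-assoc t 1 (length W)) (shrink-shrink 1 (length W) u) ⇒-refl

  cells-alloc : ∀ {v S} → v ∈ S → ⊢ (cells S ⇒ alloc v)
  cells-alloc {v} (here refl) = ∗-mono ∧-elimˡ ⇒⊤ ⟫ ax12 v
  cells-alloc {v} (there p) = ∗-mono ⇒⊤ (cells-alloc p) ⟫ ∗-comm ⟫ ax12 v

  cells-¬alloc : ∀ {z} S → All (_∈ X) S → z ∈ X → (∀ {v} → v ∈ S → f v ≢ f z) → ⊢ ((Eqs ∧ᶠ cells S) ⇒ ~ alloc z)
  cells-¬alloc {z} [] _ z∈ _ = ∧-elimʳ ⟫ emp⇒¬alloc z
  cells-¬alloc {z} (v ∷ S) (v∈ ∷ S⊆X) z∈ distinct =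
    pure-∗ pures (cell-¬alloc v∈ z∈ (distinct (here refl))) (cells-¬alloc S S⊆X z∈ (λ p → distinct (there p))) ⟫ ax15 z

  cells-size : ∀ S → ⊢ (cells S ⇒ size= (length S))
  cells-size [] = emp⇒size=0
  cells-size (v ∷ S) = ∗-mono ∧-elimʳ (cells-size S) ⟫ size=-∗ 1 (length S)

  cells-++ : ∀ S T → ⊢ (cells (S ++ T) ⇒ (cells S ∗ cells T))
  cells-++ [] T = ∗-emp ⟫ ∗-comm
  cells-++ (v ∷ S) T = ∗-monoʳ _ (cells-++ S T) ⟫ ∗-assocˡ

  Unallocated : Form
  Unallocated = Conj (¬allocs (outside []))

  unallocated⇒¬alloc : ∀ {z} → z ∈ X → ⊢ (Unallocated ⇒ ~ alloc z)
  unallocated⇒¬alloc z∈ = conj-elim (∈-map⁺ (λ z → ~ alloc z) (∈-filter⁺ (apart? []) z∈ λ ()))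

  remaining⇒unallocated : ∀ t u → ⊢ (Remaining [] t u ⇒ Unallocated)
  remaining⇒unallocated t u = conj-intro (¬allocs (outside [])) (λ p → conj-elim (∈-++⁺ˡ p))

  split-remaining≥ : ∀ p q u → ⊢ (Remaining [] (p + q) u ⇒ ((Unallocated ∧ᶠ size= p) ∗ (Unallocated ∧ᶠ size≥ q)))
  split-remaining≥ p q u =
    ¬alloc-split (outside []) (remaining⇒unallocated (p + q) u)
      (conj-elim (remaining-intro {[]} {p + q} {u} lower) ⟫ size≥-split p q)

  split-remaining= : ∀ p q →
    ⊢ (Remaining [] (p + q) (just (suc (p + q))) ⇒ ((Unallocated ∧ᶠ size= p) ∗ (Unallocated ∧ᶠ size= q)))
  split-remaining= p q =
    ¬alloc-split (outside []) (remaining⇒unallocated (p + q) (just (suc (p + q))))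
      (∧-intro (conj-elim (remaining-intro {[]} {p + q} {u} lower)) (conj-elim (remaining-intro {[]} {p + q} {u} (upper-bound refl)))
        ⟫ size=-split p q)
    where
    u : Maybe ℕ
    u = just (suc (p + q))

pointerLits : List Lit → List Lit
pointerLits Ks = concatMap ptsPart Ks ++ concatMap (negPtsPart Ks) Ks

Pointers : List Lit → Form
Pointers Ks = Conj (map ⟦_⟧L (pointerLits Ks))

data PointerLit (Ks : List Lit) : Lit → Set where
  pts  : ∀ {x y} → pos (ptsC x y) ∈ Ks → PointerLit Ks (pos (ptsC x y))
  ¬pts : ∀ {x y} → pos (allocC x) ∈ Ks → neg (ptsC x y) ∈ Ks → PointerLit Ks (neg (ptsC x y))

module _ (Ks : List Lit) where

  private
    module C = BlockCases (PointerLit Ks) Ks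

  pointerLits-view : ∀ {L} → L ∈ pointerLits Ks → PointerLit Ks L
  pointerLits-view p with ∈-++⁻ (concatMap ptsPart Ks) p
  ... | inj₁ q = C.block ptsPart (λ k r → C.ptsPart-case k r pts) q
  ... | inj₂ q = C.block (negPtsPart Ks) (λ k r → C.negPtsPart-case k r ¬pts) q

  pointerLits-intro : ∀ {L} → PointerLit Ks L → L ∈ pointerLits Ks
  pointerLits-intro (pts p) = ∈-++⁺ˡ (concatMap-intro ptsPart p (here refl))
  pointerLits-intro (¬pts a p) =
    ∈-++⁺ʳ (concatMap ptsPart Ks) (concatMap-intro (negPtsPart Ks) p (when-intro (∈⇒occurs a)))

  Pointers-elim : ∀ {L} → PointerLit Ks L → ⊢ (Pointers Ks ⇒ ⟦ L ⟧L)
  Pointers-elim w = conj-elim (∈-map⁺ ⟦_⟧L (pointerLits-intro w))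

-- A core type Ls with a model (s, h) whose equality pattern on X is the
-- kernel of f.  Its part of the heap is described by the cells of one
-- representative per allocated location (S) and an unallocated rest.
module Side {X : List PVar} {α : ℕ} (|X|≤α : length X ≤ α) (f : PVar → ℕ)
  {E : List Form} (pures : All IsPure E)
  (eq∈ : ∀ {x y} → x ∈ X → y ∈ X → f x ≡ f y → (x ≐ y) ∈ E)
  (neq∈ : ∀ {x y} → x ∈ X → y ∈ X → f x ≢ f y → (~ (x ≐ y)) ∈ E)
  {Ls : List Lit} (ct : IsCoreType X α Ls) {s : Store} {h : Heap} (sat : s , h ⊨ ⋀ Ls)
  (s⇒f : ∀ {x y} → x ∈ X → y ∈ X → s x ≡ s y → f x ≡ f y)
  (f⇒s : ∀ {x y} → x ∈ X → y ∈ X → f x ≡ f y → s x ≡ s y) where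

  open SatisfiedType ct sat
  open Cells X f pures eq∈ neq∈
  open Representatives f

  S : List PVar
  S = reps allocVars

  S⊆allocVars : ∀ {r} → r ∈ S → r ∈ allocVars
  S⊆allocVars = reps-⊆ allocVars

  S⊆X : All (_∈ X) S
  S⊆X = All.tabulate (λ p → proj₁ (allocVars⁻ (S⊆allocVars p)))

  c : ℕ
  c = length S

  distinct-locations : ∀ T → All (_∈ X) T → Distinct T → AllPairs _≢_ (map s T)
  distinct-locations [] _ _ = []
  distinct-locations (t ∷ T) (t∈ ∷ T⊆X) (t-distinct ∷ distinct) =
    All-map⁺ (apart T T⊆X t-distinct) ∷ distinct-locations T T⊆X distinct
    where
    apart : ∀ U → All (_∈ X) U → All (λ u → f t ≢ f u) U → All (λ u → s t ≢ s u) U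
    apart [] _ _ = []
    apart (u ∷ U) (u∈ ∷ U⊆X) (ne ∷ nes) = (λ e → ne (s⇒f t∈ u∈ e)) ∷ apart U U⊆X nes

  -- the model allocates c distinct locations, so c does not exceed the threshold
  c≤m : c ≤ m
  c≤m = pos-size⇒≤m (true⇒pos c≤α (subst (λ k → s , h ⊨ size≥ k) (length-map s S)
          (⊨size≥-distinct s h (map s S) (distinct-locations S S⊆X (reps-distinct allocVars))
            (All-map⁺ (All.tabulate (λ p → holds (proj₂ (allocVars⁻ (S⊆allocVars p)))))))))
    where
    c≤α : c ≤ α
    c≤α = ≤-trans (length-reps allocVars) (≤-trans length-allocVars |X|≤α)

  cells⇒alloc : ∀ {x} → pos (allocC x) ∈ Ls → ⊢ ((Eqs ∧ᶠ cells S) ⇒ alloc x)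
  cells⇒alloc {x} p with reps-cover allocVars (allocVars⁺ (inCore p) p)
  ... | r , r∈S , e =
    alloc-transfer (∧-elimʳ ⟫ cells-alloc r∈S)
                   (∧-elimˡ ⟫ conj-elim (eq∈ (inCore p) (proj₁ (allocVars⁻ (S⊆allocVars r∈S))) (sym e)))

  cells⇒¬alloc : ∀ {x} → neg (allocC x) ∈ Ls → ⊢ ((Eqs ∧ᶠ cells S) ⇒ ~ alloc x)
  cells⇒¬alloc {x} n = cells-¬alloc S S⊆X (inCore n) not-represented
    where
    not-represented : ∀ {v} → v ∈ S → f v ≢ f x
    not-represented v∈ e =
      let (v∈X , v-alloc) = allocVars⁻ (S⊆allocVars v∈)
      in pos-and-neg (alloc-closed (inCore n) v-alloc (f⇒s v∈X (inCore n) e)) n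

  unrepresented⇒¬alloc : ∀ {z} → z ∈ X → ¬ Any (λ r → f r ≡ f z) S → neg (allocC z) ∈ Ls
  unrepresented⇒¬alloc {z} z∈ unrepresented with pos-or-neg (allocC z) z∈
  ... | inj₂ n = n
  ... | inj₁ a = let (r , r∈ , e) = reps-cover allocVars (allocVars⁺ z∈ a) in ⊥-elim (unrepresented (lose r∈ e))

  -- the rest of this side's heap: exactly m − c cells when the type
  -- bounds the size (m < α), at least m − c otherwise
  Rest : Dec (m < α) → Form
  Rest (yes _) = Unallocated ∧ᶠ size= (m ∸ c)
  Rest (no _) = Unallocated ∧ᶠ size≥ (m ∸ c)

  Part : Dec (m < α) → Form
  Part d = cells S ∗ Rest d

  exact⇒Rest : ∀ d → ⊢ ((Unallocated ∧ᶠ size= (m ∸ c)) ⇒ Rest d)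
  exact⇒Rest (yes _) = ⇒-refl
  exact⇒Rest (no _) = ∧-mono ⇒-refl ∧-elimˡ

  Rest⇒size≥ : ∀ d → ⊢ (Rest d ⇒ size≥ (m ∸ c))
  Rest⇒size≥ (yes _) = ∧-elimʳ ⟫ ∧-elimˡ
  Rest⇒size≥ (no _) = ∧-elimʳ

  Part-alloc : ∀ d {x} → pos (allocC x) ∈ Ls → ⊢ ((Eqs ∧ᶠ Part d) ⇒ alloc x)
  Part-alloc d {x} p = pure-∗ pures (cells⇒alloc p) ⇒⊤ ⟫ ax12 x

  Part-¬alloc : ∀ d {x} → neg (allocC x) ∈ Ls → ⊢ ((Eqs ∧ᶠ Part d) ⇒ ~ alloc x)
  Part-¬alloc d {x} n =
    pure-∗ pures (cells⇒¬alloc n) (∧-elimʳ ⟫ Rest-unallocated d ⟫ unallocated⇒¬alloc (inCore n)) ⟫ ax15 x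
    where
    Rest-unallocated : ∀ d → ⊢ (Rest d ⇒ Unallocated)
    Rest-unallocated (yes _) = ∧-elimˡ
    Rest-unallocated (no _) = ∧-elimˡ

  Part-size≥ : ∀ d → ⊢ (Part d ⇒ size≥ m)
  Part-size≥ d =
    ∗-mono (cells-size S ⟫ ∧-elimˡ) (Rest⇒size≥ d) ⟫ size≥-∗ c (m ∸ c) ⟫
    subst (λ k → ⊢ (size≥ (c + (m ∸ c)) ⇒ size≥ k)) (m+[n∸m]≡n c≤m) ⇒-refl

  Part-¬size≥ : ∀ d → m < α → ⊢ (Part d ⇒ ~ size≥ (suc m))
  Part-¬size≥ (yes _) _ =
    ∗-mono (cells-size S ⟫ ∧-elimʳ) (∧-elimʳ ⟫ ∧-elimʳ) ⟫ ax19 (suc c) (suc (m ∸ c)) ⟫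
    subst (λ k → ⊢ (~ size≥ (c + suc (m ∸ c)) ⇒ ~ size≥ k)) (trans (+-suc c (m ∸ c)) (cong suc (m+[n∸m]≡n c≤m))) ⇒-refl
  Part-¬size≥ (no m≮α) m<α = ⊥-elim (m≮α m<α)

  Part⇒type : ∀ d → ⊢ ((Pointers Ls ∧ᶠ (Eqs ∧ᶠ Part d)) ⇒ ⋀ Ls)
  Part⇒type d = ⋀-intro Ls lit
    where
    lit : ∀ {L} → L ∈ Ls → ⊢ ((Pointers Ls ∧ᶠ (Eqs ∧ᶠ Part d)) ⇒ ⟦ L ⟧L)
    lit {pos (eqC x y)} p =
      let (x∈ , y∈) = inCore p in ∧-elimʳ ⟫ ∧-elimˡ ⟫ conj-elim (eq∈ x∈ y∈ (s⇒f x∈ y∈ (holds p)))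
    lit {neg (eqC x y)} p =
      let (x∈ , y∈) = inCore p in ∧-elimʳ ⟫ ∧-elimˡ ⟫ conj-elim (neq∈ x∈ y∈ (λ e → holds p (f⇒s x∈ y∈ e)))
    lit {pos (allocC x)} p = ∧-elimʳ ⟫ Part-alloc d p
    lit {neg (allocC x)} p = ∧-elimʳ ⟫ Part-¬alloc d p
    lit {pos (ptsC x y)} p = ∧-elimˡ ⟫ Pointers-elim Ls (pts p)
    lit {neg (ptsC x y)} p with pos-or-neg (allocC x) (proj₁ (inCore p))
    ... | inj₁ a = ∧-elimˡ ⟫ Pointers-elim Ls (¬pts a p)
    ... | inj₂ ¬a = ∧-elimʳ ⟫ Part-¬alloc d ¬a ⟫ contrapos (ax3 x y)
    lit {pos (sizeC β)} p = ∧-elimʳ ⟫ ∧-elimʳ ⟫ Part-size≥ d ⟫ size≥-mono (pos-size⇒≤m p)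
    lit {neg (sizeC β)} p =
      ∧-elimʳ ⟫ ∧-elimʳ ⟫ Part-¬size≥ d (≤-trans (neg-size⇒m< p) (inCore p)) ⟫ ¬size≥-mono (neg-size⇒m< p)

∸-+-interchange : ∀ {m₁ m₂ c₁ c₂} → c₁ ≤ m₁ → c₂ ≤ m₂ → (m₁ + m₂) ∸ (c₁ + c₂) ≡ (m₁ ∸ c₁) + (m₂ ∸ c₂)
∸-+-interchange {m₁} {m₂} {c₁} {c₂} c₁≤m₁ c₂≤m₂ = begin
  (m₁ + m₂) ∸ (c₁ + c₂)  ≡⟨ sym (∸-+-assoc (m₁ + m₂) c₁ c₂) ⟩
  (m₁ + m₂) ∸ c₁ ∸ c₂    ≡⟨ cong (_∸ c₂) (+-∸-comm m₂ c₁≤m₁) ⟩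
  (m₁ ∸ c₁ + m₂) ∸ c₂    ≡⟨ +-∸-assoc (m₁ ∸ c₁) c₂≤m₂ ⟩
  (m₁ ∸ c₁) + (m₂ ∸ c₂)  ∎
  where open ≡-Reasoning

suc-∸-+-interchange : ∀ {m₁ m₂ c₁ c₂} → c₁ ≤ m₁ → c₂ ≤ m₂ → suc (m₁ + m₂) ∸ (c₁ + c₂) ≡ suc ((m₁ ∸ c₁) + (m₂ ∸ c₂))
suc-∸-+-interchange c₁≤m₁ c₂≤m₂ =
  trans (+-∸-assoc 1 (+-mono-≤ c₁≤m₁ c₂≤m₂)) (cong suc (∸-+-interchange c₁≤m₁ c₂≤m₂))

-- The main case: the models share their equality pattern on X (we take
-- f = s₁) and no variable is allocated in both types.
module Backward {X : List PVar} {α : ℕ} (|X|≤α : length X ≤ α) {Ls Ms : List Lit}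
  (ctL : IsCoreType X α Ls) (ctM : IsCoreType X α Ms)
  {s₁ : Store} {h₁ : Heap} (satL : s₁ , h₁ ⊨ ⋀ Ls) {s₂ : Store} {h₂ : Heap} (satM : s₂ , h₂ ⊨ ⋀ Ms)
  (s₁⇒s₂ : ∀ {x y} → x ∈ X → y ∈ X → s₁ x ≡ s₁ y → s₂ x ≡ s₂ y)
  (s₂⇒s₁ : ∀ {x y} → x ∈ X → y ∈ X → s₂ x ≡ s₂ y → s₁ x ≡ s₁ y)
  (no-common-alloc : ∀ {x} → pos (allocC x) ∈ Ls → pos (allocC x) ∈ Ms → Empty) where

  module TL = SatisfiedType ctL satL
  module TM = SatisfiedType ctM satM

  Box : Form
  Box = Box∗ Ls Ms

  box⊢ : ∀ {L} → BoxWitness Ls Ms L → ⊢ (Box ⇒ ⟦ L ⟧L)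
  box⊢ = box⇒

  -- the (dis)equalities of Ls, which fix the equality pattern s₁ on X
  E : List Form
  E = map ⟦_⟧L (concatMap eqPart Ls)

  pures : All IsPure E
  pures = All-map⁺ (All.tabulate (P.block eqPart (λ k q → P.eqPart-case k q (λ _ → eq-pure _ _) (λ _ → neq-pure _ _))))
    where
    module P = BlockCases (λ L → IsPure ⟦ L ⟧L) Ls

  eq∈ : ∀ {x y} → x ∈ X → y ∈ X → s₁ x ≡ s₁ y → (x ≐ y) ∈ E
  eq∈ x∈ y∈ e = ∈-map⁺ ⟦_⟧L (concatMap-intro eqPart (TL.true⇒pos {eqC _ _} (x∈ , y∈) e) (here refl))

  neq∈ : ∀ {x y} → x ∈ X → y ∈ X → s₁ x ≢ s₁ y → (~ (x ≐ y)) ∈ E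
  neq∈ x∈ y∈ ne = ∈-map⁺ ⟦_⟧L (concatMap-intro eqPart (TL.false⇒neg {eqC _ _} (x∈ , y∈) ne) (here refl))

  open Cells X s₁ pures eq∈ neq∈
  open Representatives s₁ using (Distinct; reps-distinct)
  module L = Side |X|≤α s₁ pures eq∈ neq∈ ctL satL (λ _ _ e → e) (λ _ _ e → e)
  module M = Side |X|≤α s₁ pures eq∈ neq∈ ctM satM s₂⇒s₁ s₁⇒s₂

  -- Box∗ opens with the (dis)equalities of Ls
  box⇒Eqs : ⊢ (Box ⇒ Eqs)
  box⇒Eqs = conj-intro E λ p →
    let (L , q , e) = ∈-map⁻ ⟦_⟧L p in subst (λ g → ⊢ (Box ⇒ g)) (sym e) (⋀-elim {Ls = boxLits Ls Ms} (∈-++⁺ˡ q))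

  W : List PVar
  W = L.S ++ M.S

  W⊆X : All (_∈ X) W
  W⊆X = All-++⁺ L.S⊆X M.S⊆X

  W-distinct : Distinct W
  W-distinct = AllPairs-++⁺ (reps-distinct TL.allocVars) (reps-distinct TM.allocVars)
    (All.tabulate λ v∈ → All.tabulate λ w∈ e →
      let (v∈X , v-alloc) = TL.allocVars⁻ (L.S⊆allocVars v∈)
          (w∈X , w-alloc) = TM.allocVars⁻ (M.S⊆allocVars w∈)
      in no-common-alloc (TL.alloc-closed w∈X v-alloc e) w-alloc)

  m₁ m₂ p₁ p₂ : ℕ
  m₁ = TL.m
  m₂ = TM.m
  p₁ = m₁ ∸ L.c
  p₂ = m₂ ∸ M.c

  box⇒Remaining : ∀ u → (∀ {g} → g ∈ upper u → ⊢ (Box ⇒ g)) → ⊢ (Box ⇒ Remaining W (m₁ + m₂) u)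
  box⇒Remaining u bounded = conj-intro (remaining W (m₁ + m₂) u) (λ p → lit (remaining-view p))
    where
    lit : ∀ {g} → RemainingLit W (m₁ + m₂) u g → ⊢ (Box ⇒ g)
    lit (allocated w∈) with ∈-++⁻ L.S w∈
    ... | inj₁ w∈L = box⊢ (allocˡ (proj₂ (TL.allocVars⁻ (L.S⊆allocVars w∈L))))
    ... | inj₂ w∈M = box⊢ (allocʳ (proj₂ (TM.allocVars⁻ (M.S⊆allocVars w∈M))))
    lit (unallocated z∈ apart) =
      box⊢ (¬alloc (L.unrepresented⇒¬alloc z∈ (λ r → apart (AnyP.++⁺ˡ r)))
                   (M.unrepresented⇒¬alloc z∈ (λ r → apart (AnyP.++⁺ʳ L.S r))))
    lit lower = box⊢ (size TL.size≥m∈ TM.size≥m∈)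
    lit (upper-bound refl) = bounded (here refl)

  peeled : ∀ u → (∀ {g} → g ∈ upper u → ⊢ (Box ⇒ g)) →
           ⊢ (Box ⇒ (cells W ∗ Remaining [] (p₁ + p₂) (shrink (L.c + M.c) u)))
  peeled u bounded =
    ∧-intro box⇒Eqs (box⇒Remaining u bounded) ⟫ peel W (m₁ + m₂) u W⊆X W-distinct ⟫
    subst₂ (λ t k → ⊢ ((cells W ∗ Remaining [] (m₁ + m₂ ∸ length W) (shrink (length W) u)) ⇒
                       (cells W ∗ Remaining [] t (shrink k u))))
           (trans (cong (m₁ + m₂ ∸_) |W|) (∸-+-interchange L.c≤m M.c≤m)) |W| ⇒-refl
    where
    |W| : length W ≡ L.c + M.c
    |W| = length-++ L.S

  -- the rest splits into the rests of the two sides; if both types bound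
  -- their size, Box∗ bounds the whole heap by m₁ + m₂ + 1
  box⇒rests : ∀ d₁ d₂ → ⊢ (Box ⇒ (cells W ∗ (L.Rest d₁ ∗ M.Rest d₂)))
  box⇒rests (yes m₁<α) (yes m₂<α) =
    peeled (just (suc (m₁ + m₂))) bounded ⟫
    subst (λ u → ⊢ ((cells W ∗ Remaining [] (p₁ + p₂) (shrink (L.c + M.c) (just (suc (m₁ + m₂))))) ⇒
                    (cells W ∗ Remaining [] (p₁ + p₂) u)))
          (cong just (suc-∸-+-interchange L.c≤m M.c≤m)) ⇒-refl ⟫
    ∗-monoʳ _ (split-remaining= p₁ p₂)
    where
    bounded : ∀ {g} → g ∈ upper (just (suc (m₁ + m₂))) → ⊢ (Box ⇒ g)
    bounded (here refl) =
      subst (λ k → ⊢ (Box ⇒ ~ size≥ k)) (+-suc m₁ m₂) (box⊢ (¬size (TL.¬size≥1+m∈ m₁<α) (TM.¬size≥1+m∈ m₂<α)))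
  box⇒rests (yes _) (no _) = peeled nothing (λ ()) ⟫ ∗-monoʳ _ (split-remaining≥ p₁ p₂ nothing)
  box⇒rests (no _) d =
    peeled nothing (λ ()) ⟫
    ∗-monoʳ _ (subst (λ t → ⊢ (Remaining [] t nothing ⇒ ((Unallocated ∧ᶠ size= p₂) ∗ (Unallocated ∧ᶠ size≥ p₁))))
                      (+-comm p₂ p₁) (split-remaining≥ p₂ p₁ nothing) ⟫
               ∗-comm ⟫ ∗-monoʳ _ (M.exact⇒Rest d))

  d₁ : Dec (m₁ < α)
  d₁ = m₁ <? α

  d₂ : Dec (m₂ < α)
  d₂ = m₂ <? α

  box⇒parts : ⊢ (Box ⇒ (L.Part d₁ ∗ M.Part d₂))
  box⇒parts = box⇒rests d₁ d₂ ⟫ ∗-monoˡ _ (cells-++ L.S M.S) ⟫ ∗-interchange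

  -- each retained pointer literal belongs to the part of its own side
  left-pointers : ∀ {g B} → g ∈ map ⟦_⟧L (pointerLits Ls) → ⊢ (~ (Box ∧ᶠ ((~ g ∧ᶠ (Eqs ∧ᶠ L.Part d₁)) ∗ B)))
  left-pointers p with ∈-map⁻ ⟦_⟧L p
  ... | L , q , refl with pointerLits-view Ls q
  ...   | pts k = pts-stays (L.Part-alloc d₁ (TL.pts⇒alloc k)) (box⊢ (ptsˡ k))
  ...   | ¬pts a k = ¬pts-stays (box⊢ (¬ptsˡ a k))

  right-pointers : ∀ {g A} → g ∈ map ⟦_⟧L (pointerLits Ms) → ⊢ (~ (Box ∧ᶠ (A ∗ (~ g ∧ᶠ (Eqs ∧ᶠ M.Part d₂)))))
  right-pointers p with ∈-map⁻ ⟦_⟧L p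
  ... | L , q , refl with pointerLits-view Ms q
  ...   | pts k = refute-along (∧-mono ⇒-refl ∗-comm) (pts-stays (M.Part-alloc d₂ (TM.pts⇒alloc k)) (box⊢ (ptsʳ k)))
  ...   | ¬pts a k = refute-along (∧-mono ⇒-refl ∗-comm) (¬pts-stays (box⊢ (¬ptsʳ a k)))

  box⇒types : ⊢ (Box ⇒ (⋀ Ls ∗ ⋀ Ms))
  box⇒types =
    ∧-intro ⇒-refl box⇒parts ⟫
    ∧-intro ∧-elimˡ (∧-mono box⇒Eqs ⇒-refl ⟫ pure-∗ pures ⇒-refl ⇒-refl) ⟫
    ∧-intro ∧-elimˡ (strengthenAllˡ (map ⟦_⟧L (pointerLits Ls)) left-pointers) ⟫
    strengthenAllʳ (map ⟦_⟧L (pointerLits Ms)) right-pointers ⟫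
    ∗-mono (L.Part⇒type d₁) (M.Part⇒type d₂)

box-clash-eqˡ : ∀ {Ls Ms x y D} → pos (eqC x y) ∈ Ls → neg (eqC x y) ∈ Ms → ⊢ (Box∗ Ls Ms ⇒ D)
box-clash-eqˡ {Ls} {Ms} p n = explode (box⇒ {Ls} {Ms} (eqˡ p)) (box⇒ {Ls} {Ms} (neqʳ n))

box-clash-eqʳ : ∀ {Ls Ms x y D} → pos (eqC x y) ∈ Ms → neg (eqC x y) ∈ Ls → ⊢ (Box∗ Ls Ms ⇒ D)
box-clash-eqʳ {Ls} {Ms} p n = explode (box⇒ {Ls} {Ms} (eqʳ p)) (box⇒ {Ls} {Ms} (neqˡ n))

box-clash-alloc : ∀ {Ls Ms x D} → pos (allocC x) ∈ Ls → pos (allocC x) ∈ Ms → ⊢ (Box∗ Ls Ms ⇒ D)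
box-clash-alloc {Ls} {Ms} {x} a a' = explode (weaken (ax1 x)) (box⇒ {Ls} {Ms} (self≠ a a'))

equalities-transfer? : ∀ (s s' : Store) X →
  (∀ {x y} → x ∈ X → y ∈ X → s x ≡ s y → s' x ≡ s' y) ⊎
  (∃ λ x → ∃ λ y → x ∈ X × y ∈ X × s x ≡ s y × s' x ≢ s' y)
equalities-transfer? s s' X with any? (λ x → any? (λ y → (s x ≟ s y) ×-dec ¬? (s' x ≟ s' y)) X) X
... | yes found =
  let (x , x∈ , found') = find found
      (y , y∈ , e , ne) = find found'
  in inj₂ (x , y , x∈ , y∈ , e , ne)
... | no none = inj₁ transfer
  where
  transfer : ∀ {x y} → x ∈ X → y ∈ X → s x ≡ s y → s' x ≡ s' y
  transfer {x} {y} x∈ y∈ e with s' x ≟ s' y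
  ... | yes e' = e'
  ... | no ne = ⊥-elim (none (lose x∈ (lose y∈ (e , ne))))

backward : ∀ {X α Ls Ms} → length X ≤ α → IsCoreType X α Ls → IsCoreType X α Ms →
           Satisfiable (⋀ Ls) → Satisfiable (⋀ Ms) → ⊢ (Box∗ Ls Ms ⇒ (⋀ Ls ∗ ⋀ Ms))
backward {X} {Ls = Ls} {Ms} |X|≤α ctL ctM (s₁ , h₁ , satL) (s₂ , h₂ , satM)
  with equalities-transfer? s₁ s₂ X | equalities-transfer? s₂ s₁ X
     | any? (λ x → (pos (allocC x) ∈? Ls) ×-dec (pos (allocC x) ∈? Ms)) X
... | inj₂ (x , y , x∈ , y∈ , e , ne) | _ | _ =
  box-clash-eqˡ (SatisfiedType.true⇒pos ctL satL {eqC x y} (x∈ , y∈) e)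
                (SatisfiedType.false⇒neg ctM satM {eqC x y} (x∈ , y∈) ne)
... | inj₁ _ | inj₂ (x , y , x∈ , y∈ , e , ne) | _ =
  box-clash-eqʳ (SatisfiedType.true⇒pos ctM satM {eqC x y} (x∈ , y∈) e)
                (SatisfiedType.false⇒neg ctL satL {eqC x y} (x∈ , y∈) ne)
... | inj₁ _ | inj₁ _ | yes common = let (_ , _ , (a , a')) = find common in box-clash-alloc a a'
... | inj₁ s₁⇒s₂ | inj₁ s₂⇒s₁ | no none =
  Backward.box⇒types |X|≤α ctL ctM satL satM s₁⇒s₂ s₂⇒s₁
    (λ a a' → none (lose (SatisfiedType.inCore ctL satL a) (a , a')))

lemma5p4 : (X : List ℕ) → Unique X → (α : ℕ) → length X ≤ α →
    (Ls Ms : List Lit) → IsCoreType X α Ls → IsCoreType X α Ms →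
    Satisfiable (⋀ Ls) → Satisfiable (⋀ Ms) →
    ⊢ ((⋀ Ls ∗ ⋀ Ms) ⇔ Box∗ Ls Ms)
lemma5p4 X _ α |X|≤α Ls Ms ctL ctM satL satM = ⇔-intro (∗⇒box {Ls} {Ms}) (backward |X|≤α ctL ctM satL satM)
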